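{- Let $n,d,r$ be positive integers and $\pi=(\pi_1\mid\cdots\mid\pi_d)\in\mathcal{OP}(n,d,r)$. Let $c_n\in\mathfrak{S}_n$ be the long cycle $n\,1\,2\cdots(n-1)$ in one-line notation (so $c_n(1)=n$ and $c_n(j)=j-1$ for $j\ge2$) and $w_0\in\mathfrak{S}_n$ the long element $w_0(j)=n+1-j$. Let $\mathtt{rot}(\pi)=(c_n\cdot\pi_1\mid\cdots\mid c_n\cdot\pi_d)$ (counterclockwise rotation of the diagram of $\pi$ by $360/n$ degrees, the labels $1,\dots,n$ being placed clockwise on a circle) and $\mathtt{refl}(\pi)=(w_0\cdot\pi_1\mid\cdots\mid w_0\cdot\pi_d)$ (reflection across the diameter with an endpoint halfway between $n$ and $1$), where $w\cdot B=\{w(b):b\in B\}$. Then $$c_n\cdot[\pi]_r=(-1)^{n-1}[\mathtt{rot}(\pi)]_r\quad\text{and}\quad w_0\cdot[\pi]_r=(-1)^{\binom n2}[\mathtt{refl}(\pi)]_r.$$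
   Context: An ordered set partition of $[n]$ with $d$ blocks is a sequence $\pi=(\pi_1\mid\cdots\mid\pi_d)$ of nonempty pairwise disjoint subsets of $[n]$ with union $[n]$; $\mathcal{OP}(n,d,r)$ is the set of those with every block of size at least $r$. Let $M=(x_{ij})_{1\le i,j\le n}$ be an $n\times n$ matrix of distinct indeterminates; $M_I^J$ is the determinant of the submatrix with rows $I$ and columns $J$ (both increasing). $\mathfrak{S}_n$ acts on $\mathbb{C}[M]$ by permuting columns: $w\cdot f$ is obtained from $f$ by substituting $x_{ij}\mapsto x_{i,w(j)}$. For $\pi\in\mathcal{OP}(n,d,r)$, an $r$-jellyfish tableau for $\pi$ is an array $T$ with $n-(d-1)r$ rows and $d$ columns, cells empty or containing elements of $[n]$, such that all cells in rows $1,\dots,r$ are nonempty, each row $i>r$ has exactly one nonempty cell, and the nonempty entries of column $j$ are exactly $\pi_j$, increasing downward; $\mathcal{J}_r(\pi)$ is their set. $\mathrm{sgn}(T)=(-1)^{\mathrm{inv}(T)}$, $\mathrm{inv}(T)$ being the number of inversions of the row reading word (rows left to right, top to bottom, empty cells skipped). $\mathrm{J}(T)=\prod_jM^{\pi_j}_{R_j(T)}$ with $R_j(T)$ the set of rows in which column $j$ is nonempty, and $[\pi]_r=\sum_{T\in\mathcal{J}_r(\pi)}\mathrm{sgn}(T)\mathrm{J}(T)$. -}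

module Defs where

open import Level using (Level)
open import Data.Bool using (Bool; true; false; _∧_; if_then_else_)
open import Data.Nat as ℕ using (ℕ; zero; suc; _∸_; _≡ᵇ_; _<ᵇ_)
open import Data.Nat.Properties using (m∸n≤m)
open import Data.Fin as Fin using (Fin; toℕ; fromℕ; inject₁; inject≤; opposite)
open import Data.Maybe using (Maybe; just; nothing; is-just)
open import Data.List using (List; []; _∷_; _++_; [_]; map; concatMap; mapMaybe; allFin; filterᵇ; length; foldr)
open import Data.Bool.ListAction using (all; any)
open import Data.Vec.Functional using () renaming (_∷_ to _∷ᶠ_)
open import Algebra.Bundles using (CommutativeRing)

_=ᶠ_ : ∀ {n} → Fin n → Fin n → Bool
a =ᶠ b = toℕ a ≡ᵇ toℕ b

_<ᶠ_ : ∀ {n} → Fin n → Fin n → Bool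
a <ᶠ b = toℕ a <ᵇ toℕ b

listEqᵇ : ∀ {n} → List (Fin n) → List (Fin n) → Bool
listEqᵇ []       []       = true
listEqᵇ (x ∷ xs) (y ∷ ys) = (x =ᶠ y) ∧ listEqᵇ xs ys
listEqᵇ _        _        = false

allFuns : ∀ {a} {A : Set a} (k : ℕ) → List A → List (Fin k → A)
allFuns zero    xs = (λ ()) ∷ []
allFuns (suc k) xs = concatMap (λ x → map (λ f → x ∷ᶠ f) (allFuns k xs)) xs

-- Ordered set partitions.  An ordered set partition (π₁|…|π_d) of [n]
-- (labels 1..n ↔ Fin n elements 0..n-1) is encoded by its block map
-- blk : Fin n → Fin d  (x ∈ π_j  iff  blk x = j).

blockOf : ∀ {n d} → (Fin n → Fin d) → Fin d → List (Fin n)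
blockOf {n} blk j = filterᵇ (λ x → blk x =ᶠ j) (allFin n)

-- π ∈ OP(n,d,r): every block has size ≥ r (nonemptiness follows since r ≥ 1)
InOP : (n d r : ℕ) → (Fin n → Fin d) → Set
InOP n d r blk = ∀ j → r ℕ.≤ length (blockOf blk j)

-- A general "sequence of d subsets of [n]" given by membership tests;
-- used for the images w·π_j.
Blocks : ℕ → ℕ → Set
Blocks n d = Fin d → Fin n → Bool

blocksOf : ∀ {n d} → (Fin n → Fin d) → Blocks n d
blocksOf blk j x = blk x =ᶠ j

act : ∀ {n d} → (Fin n → Fin n) → Blocks n d → Blocks n d
act {n} w B j x = any (λ b → B j b ∧ (w b =ᶠ x)) (allFin n)

elems : ∀ {n d} → Blocks n d → Fin d → List (Fin n)
elems {n} B j = filterᵇ (B j) (allFin n)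

-- The permutations c_n and w_0 (on 0-based labels).
-- c_n(1) = n, c_n(j) = j-1 (j ≥ 2):  0 ↦ n-1,  k+1 ↦ k
cyc : ∀ {n} → Fin n → Fin n
cyc {suc m} Fin.zero    = fromℕ m
cyc {suc m} (Fin.suc k) = inject₁ k

-- w_0(j) = n+1-j :  i ↦ n-1-i
w₀ : ∀ {n} → Fin n → Fin n
w₀ = opposite

rot : ∀ {n d} → Blocks n d → Blocks n d
rot = act cyc

refl' : ∀ {n d} → Blocks n d → Blocks n d
refl' = act w₀

numRows : ℕ → ℕ → ℕ → ℕ
numRows n d r = n ∸ (d ∸ 1) ℕ.* r

Array : ℕ → ℕ → ℕ → Set
Array N d n = Fin N → Fin d → Maybe (Fin n)

allArrays : (N d n : ℕ) → List (Array N d n)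
allArrays N d n = allFuns N (allFuns d (nothing ∷ map just (allFin n)))

colEntries : ∀ {N d n} → Array N d n → Fin d → List (Fin n)
colEntries {N} T j = mapMaybe (λ i → T i j) (allFin N)

rowsOf : ∀ {N d n} → Array N d n → Fin d → List (Fin N)
rowsOf {N} T j = filterᵇ (λ i → is-just (T i j)) (allFin N)

isJellyfish : ∀ {N d n} → ℕ → Blocks n d → Array N d n → Bool
isJellyfish {N} {d} {n} r B T =
  all (λ i → if toℕ i <ᵇ r
               then all (λ j → is-just (T i j)) (allFin d)
               else (length (filterᵇ (λ j → is-just (T i j)) (allFin d)) ≡ᵇ 1))
      (allFin N)
  ∧ all (λ j → listEqᵇ (colEntries T j) (elems B j)) (allFin d)

readingWord : ∀ {N d n} → Array N d n → List (Fin n)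
readingWord {N} {d} T = concatMap (λ i → mapMaybe (λ j → T i j) (allFin d)) (allFin N)

inv : ∀ {n} → List (Fin n) → ℕ
inv []       = 0
inv (x ∷ xs) = length (filterᵇ (λ y → y <ᶠ x) xs) ℕ.+ inv xs

-- Ring-valued part: evaluation of the polynomials at a matrix M over an
-- arbitrary commutative ring.

module _ {c ℓ} (R : CommutativeRing c ℓ) where
  open CommutativeRing R

  signPow : ℕ → Carrier
  signPow zero    = 1#
  signPow (suc k) = - signPow k

  sumR : List Carrier → Carrier
  sumR = foldr _+_ 0#

  prodR : List Carrier → Carrier
  prodR = foldr _*_ 1#

  mutual
    minorDet : ∀ {n} → (Fin n → Fin n → Carrier) → List (Fin n) → List (Fin n) → Carrier
    minorDet M []       []       = 1#
    minorDet M []       (_ ∷ _)  = 0#   -- size mismatch (never used)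
    minorDet M (i ∷ is) cs       = laplace M i is [] cs 0

    laplace : ∀ {n} → (Fin n → Fin n → Carrier) → Fin n → List (Fin n) →
              List (Fin n) → List (Fin n) → ℕ → Carrier
    laplace M i is pre []         k = 0#
    laplace M i is pre (c' ∷ post) k =
      (signPow k * M i c') * minorDet M is (pre ++ post)
        + laplace M i is (pre ++ [ c' ]) post (suc k)

  Jpoly : ∀ {n d} → (M : Fin n → Fin n → Carrier) → (r : ℕ) → Blocks n d →
          Array (numRows n d r) d n → Carrier
  Jpoly {n} {d} M r B T =
    prodR (map (λ j → minorDet M (map (λ i → inject≤ i (m∸n≤m n ((d ∸ 1) ℕ.* r))) (rowsOf T j))
                                 (elems B j))
               (allFin d))

  bracket : ∀ {n d} → (M : Fin n → Fin n → Carrier) → (r : ℕ) → Blocks n d → Carrier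
  bracket {n} {d} M r B =
    sumR (map (λ T → signPow (inv (readingWord T)) * Jpoly M r B T)
              (filterᵇ (isJellyfish r B) (allArrays (numRows n d r) d n)))

  -- (w·f)(M) = f(M') with M'_{ij} = M_{i,w(j)}  (substitution x_ij ↦ x_{i,w(j)})
  permCols : ∀ {n} → (Fin n → Fin n) → (Fin n → Fin n → Carrier) → (Fin n → Fin n → Carrier)
  permCols w M i j = M i (w j)

{-# OPTIONS --safe #-}

-- Both identities are the case w = c_n, w = w₀ of one statement: for an injective w,
-- [π]_r at M∘w equals (-1)^inv(w) [w·π]_r at M, where inv(c_n) = n - 1 and inv(w₀) = n choose 2.
-- A jellyfish tableau T of π is sent to the tableau of w·π with the same shape whose columns
-- hold the sorted images w·π_j; this is a bijection. Applying w to the entries of T turns the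
-- minors of M∘w into minors of M and the reading word u into w∘u, and since u is a permutation
-- of [n], (-1)^inv(w∘u) = (-1)^inv(u) (-1)^inv(w). Sorting each column afterwards is a sequence
-- of adjacent exchanges of distinct entries; each one flips the sign of the minor (minors are
-- alternating in their columns) and of the reading word (it transposes two letters), so the
-- term is unchanged.

module Submission where

open import Defs
open import Level using (Level; _⊔_)
open import Function using (_∘_; id; const; case_of_)
open import Function.Bundles using (Equivalence)
open import Data.Bool using (Bool; true; false; T; _∧_; if_then_else_)
open import Data.Bool.Properties using (T-∧)
open import Data.Bool.ListAction using (all; and)
open import Data.Empty using (⊥-elim)
open import Data.Product using (∃; ∃₂; _×_; _,_; proj₁; proj₂)
open import Data.Sum using (inj₁; inj₂)
open import Data.Nat as ℕ using (ℕ; zero; suc; _∸_; _<_; _<ᵇ_; _≡ᵇ_; s≤s; z≤n)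
open import Data.Nat.Properties as ℕ using (≡ᵇ⇒≡; ≡⇒≡ᵇ; <ᵇ⇒<; <⇒<ᵇ)
open import Data.Nat.Combinatorics using (_C_; nC1≡n; nCk+nC[k+1]≡[n+1]C[k+1])
open import Data.Fin as Fin using (Fin; toℕ; fromℕ; inject₁; inject≤; opposite; _≟_)
open import Data.Fin.Properties as Fin
  using (toℕ-injective; toℕ-inject₁; toℕ-fromℕ; toℕ<n; opposite-involutive; ≤-decTotalOrder; ≤-totalOrder)
open import Data.Maybe as Maybe using (Maybe; just; nothing; is-just; maybe′)
open import Data.Vec.Functional using (updateAt) renaming (_∷_ to _∷ᶠ_)
open import Data.Vec.Functional.Properties using (updateAt-updates; updateAt-minimal)
open import Data.List as List
  using (List; []; _∷_; _++_; [_]; map; length; filterᵇ; allFin; mapMaybe; concatMap)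
open import Data.List.Properties as List
  using (++-assoc; map-tabulate; map-++; length-map; filter-accept; filter-reject; filter-none)
open import Data.List.Membership.Propositional using (_∈_; lose)
open import Data.List.Membership.Propositional.Properties
  using (∈-allFin; ∈-∃++; ∈-++⁺ˡ; ∈-++⁺ʳ; ∈-++⁻; ∈-filter⁺; ∈-filter⁻; ∈-map⁺; ∈-map⁻)
open import Data.List.Relation.Unary.All as All using (All; []; _∷_)
import Data.List.Relation.Unary.All.Properties as Allₚ
open import Data.List.Relation.Unary.Any as Any using (here; there)
import Data.List.Relation.Unary.Any.Properties as Anyₚ
open import Data.List.Relation.Unary.AllPairs using (AllPairs; []; _∷_)
import Data.List.Relation.Unary.AllPairs.Properties as AllPairsₚ
import Data.List.Relation.Unary.Linked as Linked
import Data.List.Relation.Unary.Linked.Properties as Linkedₚ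
import Data.List.Relation.Unary.Sorted.TotalOrder.Properties as Sortedₚ
open import Data.List.Relation.Unary.Unique.Propositional using (Unique)
import Data.List.Relation.Unary.Unique.Propositional.Properties as Uniqueₚ
open import Data.List.Relation.Binary.Permutation.Propositional as ↭
  using (_↭_; ↭-refl; ↭-reflexive; ↭-sym; ↭-trans; ↭⇒↭ₛ)
open import Data.List.Relation.Binary.Permutation.Propositional.Properties
  using (shift; shifts; ++⁺ˡ; ∈-resp-↭; ↭-length; filter-↭)
import Data.List.Relation.Binary.Permutation.Setoid.Properties as ↭ₛ
open import Data.List.Relation.Binary.Equality.Propositional using (≋⇒≡)
open import Relation.Nullary using (¬_; yes; no)
open import Relation.Nullary.Decidable using (T?)
open import Relation.Binary.Definitions using (tri<; tri≈; tri>)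
open import Relation.Binary.PropositionalEquality as ≡
  using (_≡_; _≢_; refl; cong; cong₂; subst; subst₂)
open import Algebra.Bundles using (CommutativeRing)

module _ {n : ℕ} where
  open import Data.List.Sort.InsertionSort.Base (≤-decTotalOrder n) using (insert; sort) public
  open import Data.List.Sort.InsertionSort.Properties (≤-decTotalOrder n) using (sort-↭; sort-↗) public
  open import Data.List.Relation.Unary.Sorted.TotalOrder (≤-totalOrder n) using (Sorted) public

private
  variable
    a : Level
    A : Set a
    n N d : ℕ

=ᶠ⇒≡ : {x y : Fin n} → T (x =ᶠ y) → x ≡ y
=ᶠ⇒≡ {x = x} {y} = toℕ-injective ∘ ≡ᵇ⇒≡ (toℕ x) (toℕ y)

≡⇒=ᶠ : {x y : Fin n} → x ≡ y → T (x =ᶠ y)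
≡⇒=ᶠ {x = x} {y} = ≡⇒≡ᵇ (toℕ x) (toℕ y) ∘ cong toℕ

<ᶠ⇒< : {x y : Fin n} → T (x <ᶠ y) → x Fin.< y
<ᶠ⇒< {x = x} {y} = <ᵇ⇒< (toℕ x) (toℕ y)

listEqᵇ⇒≡ : (xs ys : List (Fin n)) → T (listEqᵇ xs ys) → xs ≡ ys
listEqᵇ⇒≡ []       []       _ = refl
listEqᵇ⇒≡ (x ∷ xs) (y ∷ ys) e =
  let x=y , xs=ys = Equivalence.to (T-∧ {x =ᶠ y}) e
  in cong₂ _∷_ (=ᶠ⇒≡ x=y) (listEqᵇ⇒≡ xs ys xs=ys)

listEqᵇ-refl : (xs : List (Fin n)) → T (listEqᵇ xs xs)
listEqᵇ-refl []       = _
listEqᵇ-refl (x ∷ xs) = Equivalence.from T-∧ (≡⇒=ᶠ {x = x} refl , listEqᵇ-refl xs)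

map-allFin-suc : ∀ {k} (f : Fin (suc k) → A) → map f (allFin (suc k)) ≡ f Fin.zero ∷ map (f ∘ Fin.suc) (allFin k)
map-allFin-suc f = cong (f Fin.zero ∷_) (≡.trans (map-tabulate Fin.suc f) (≡.sym (map-tabulate id (f ∘ Fin.suc))))

T-ext : ∀ {x y} → (T x → T y) → (T y → T x) → x ≡ y
T-ext {false} {false} _ _ = refl
T-ext {false} {true}  _ y⇒x = ⊥-elim (y⇒x _)
T-ext {true}  {false} x⇒y _ = ⊥-elim (x⇒y _)
T-ext {true}  {true}  _ _ = refl

#smaller : Fin n → List (Fin n) → ℕ
#smaller x xs = length (filterᵇ (λ y → y <ᶠ x) xs)

#smaller-↭ : ∀ (x : Fin n) {xs ys} → xs ↭ ys → #smaller x xs ≡ #smaller x ys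
#smaller-↭ x p = ↭-length (filter-↭ (T? ∘ λ y → y <ᶠ x) p)

#smaller-≤ : ∀ {x : Fin n} {xs} → All (x Fin.≤_) xs → #smaller x xs ≡ 0
#smaller-≤ {x = x} x≤xs =
  cong length (filter-none (T? ∘ λ y → y <ᶠ x) (All.map (λ x≤y y<x → ℕ.<⇒≱ (<ᶠ⇒< y<x) x≤y) x≤xs))

#smaller-< : ∀ {x y : Fin n} xs → y Fin.< x → #smaller x (y ∷ xs) ≡ suc (#smaller x xs)
#smaller-< {x = x} xs y<x = cong length (filter-accept (T? ∘ λ y → y <ᶠ x) (<⇒<ᵇ y<x))

#smaller-≮ : ∀ {x y : Fin n} xs → ¬ y Fin.< x → #smaller x (y ∷ xs) ≡ #smaller x xs
#smaller-≮ {x = x} xs y≮x = cong length (filter-reject (T? ∘ λ y → y <ᶠ x) (y≮x ∘ <ᶠ⇒<))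

inv-ascending : {xs : List (Fin n)} → AllPairs Fin._≤_ xs → inv xs ≡ 0
inv-ascending []              = refl
inv-ascending (x≤xs ∷ xs↗) = cong₂ ℕ._+_ (#smaller-≤ x≤xs) (inv-ascending xs↗)

inv-sorted : {xs : List (Fin n)} → Sorted xs → inv xs ≡ 0
inv-sorted = inv-ascending ∘ Linkedₚ.Linked⇒AllPairs Fin.≤-trans

inv-swap : ∀ (P : List (Fin n)) a b Q → b Fin.< a → inv (P ++ a ∷ b ∷ Q) ≡ suc (inv (P ++ b ∷ a ∷ Q))
inv-swap []      a b Q b<a = begin
  #smaller a (b ∷ Q) + (#smaller b Q + inv Q)  ≡⟨ cong (_+ _) (#smaller-< Q b<a) ⟩
  suc (#smaller a Q + (#smaller b Q + inv Q))  ≡⟨ cong suc (+-exchange (#smaller a Q) (#smaller b Q) (inv Q)) ⟩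
  suc (#smaller b Q + (#smaller a Q + inv Q))  ≡⟨ cong (λ k → suc (k + _)) (#smaller-≮ Q (ℕ.<⇒≯ b<a)) ⟨
  suc (#smaller b (a ∷ Q) + (#smaller a Q + inv Q)) ∎
  where
  open ≡.≡-Reasoning
  open import Data.Nat using (_+_)
  open import Algebra.Properties.CommutativeSemigroup ℕ.+-commutativeSemigroup
    renaming (x∙yz≈y∙xz to +-exchange)
inv-swap (p ∷ P) a b Q b<a =
  ≡.trans (cong₂ ℕ._+_ (#smaller-↭ p (++⁺ˡ P (↭.swap a b ↭-refl))) (inv-swap P a b Q b<a))
          (ℕ.+-suc _ _)

Sorted⇒≡ : {xs ys : List (Fin n)} → Sorted xs → Sorted ys → xs ↭ ys → xs ≡ ys
Sorted⇒≡ {n = n} xs↗ ys↗ p = ≋⇒≡ (Sortedₚ.↗↭↗⇒≋ (≤-totalOrder n) xs↗ ys↗ (↭⇒↭ₛ p))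

allFin-sorted : ∀ n → Sorted (allFin n)
allFin-sorted n = Linkedₚ.AllPairs⇒Linked (AllPairsₚ.tabulate⁺-< ℕ.<⇒≤)

#smaller-all : ∀ {x : Fin n} xs → All (Fin._< x) xs → #smaller x xs ≡ length xs
#smaller-all {x = x} xs xs<x = cong length (List.filter-all (T? ∘ λ y → y <ᶠ x) (All.map <⇒<ᵇ xs<x))

inv-map-order : ∀ {m} (f : Fin n → Fin m) → (∀ x y → (f x <ᶠ f y) ≡ (x <ᶠ y)) → ∀ xs → inv (map f xs) ≡ inv xs
inv-map-order f order []       = refl
inv-map-order f order (x ∷ xs) = cong₂ ℕ._+_ (#smaller-map xs) (inv-map-order f order xs)
  where
  #smaller-map : ∀ ys → #smaller (f x) (map f ys) ≡ #smaller x ys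
  #smaller-map []       = refl
  #smaller-map (y ∷ ys) rewrite order y x with y <ᶠ x
  ... | true  = cong suc (#smaller-map ys)
  ... | false = #smaller-map ys

inv-inject₁ : (xs : List (Fin n)) → inv (map inject₁ xs) ≡ inv xs
inv-inject₁ = inv-map-order inject₁ λ x y → cong₂ _<ᵇ_ (toℕ-inject₁ x) (toℕ-inject₁ y)

inject₁<fromℕ : (x : Fin n) → inject₁ x Fin.< fromℕ n
inject₁<fromℕ {n} x = subst₂ ℕ._<_ (≡.sym (toℕ-inject₁ x)) (≡.sym (toℕ-fromℕ n)) (toℕ<n x)

inv-fromℕ∷inject₁ : (xs : List (Fin n)) → inv (fromℕ n ∷ map inject₁ xs) ≡ length xs ℕ.+ inv xs
inv-fromℕ∷inject₁ xs =
  cong₂ ℕ._+_ (≡.trans (#smaller-all (map inject₁ xs) (Allₚ.map⁺ (All.tabulate λ {x} _ → inject₁<fromℕ x))) (length-map inject₁ xs))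
              (inv-inject₁ xs)

inv-cyc : ∀ n → inv (map cyc (allFin n)) ≡ n ∸ 1
inv-cyc zero    = refl
inv-cyc (suc m) = begin
  inv (map cyc (allFin (suc m)))          ≡⟨ cong inv (map-allFin-suc {k = m} cyc) ⟩
  inv (fromℕ m ∷ map inject₁ (allFin m))  ≡⟨ inv-fromℕ∷inject₁ (allFin m) ⟩
  length (allFin m) + inv (allFin m)      ≡⟨ cong₂ _+_ (List.length-tabulate id) (inv-sorted (allFin-sorted m)) ⟩
  m + 0                                   ≡⟨ ℕ.+-identityʳ m ⟩
  m                                       ∎
  where
  open ≡.≡-Reasoning
  open import Data.Nat using (_+_)

inv-w₀ : ∀ n → inv (map w₀ (allFin n)) ≡ n C 2
inv-w₀ zero    = refl
inv-w₀ (suc m) = begin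
  inv (map w₀ (allFin (suc m)))                         ≡⟨ cong inv (map-allFin-suc {k = m} w₀) ⟩
  inv (fromℕ m ∷ map (inject₁ ∘ w₀) (allFin m))         ≡⟨ cong (λ xs → inv (fromℕ m ∷ xs)) (List.map-∘ (allFin m)) ⟩
  inv (fromℕ m ∷ map inject₁ (map w₀ (allFin m)))       ≡⟨ inv-fromℕ∷inject₁ (map w₀ (allFin m)) ⟩
  length (map w₀ (allFin m)) + inv (map w₀ (allFin m))  ≡⟨ cong₂ _+_ (≡.trans (length-map w₀ (allFin m)) (List.length-tabulate id)) (inv-w₀ m) ⟩
  m + m C 2                                             ≡⟨ cong (_+ m C 2) (nC1≡n m) ⟨
  m C 1 + m C 2                                         ≡⟨ nCk+nC[k+1]≡[n+1]C[k+1] m 1 ⟩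
  suc m C 2                                             ∎
  where
  open ≡.≡-Reasoning
  open import Data.Nat using (_+_)

cyc-injective : {x y : Fin n} → cyc x ≡ cyc y → x ≡ y
cyc-injective {x = Fin.zero}  {Fin.zero}  _ = refl
cyc-injective {x = Fin.zero}  {Fin.suc y} e = ⊥-elim (Fin.fromℕ≢inject₁ e)
cyc-injective {x = Fin.suc x} {Fin.zero}  e = ⊥-elim (Fin.fromℕ≢inject₁ (≡.sym e))
cyc-injective {x = Fin.suc x} {Fin.suc y} e = cong Fin.suc (Fin.inject₁-injective e)

w₀-injective : {x y : Fin n} → w₀ x ≡ w₀ y → x ≡ y
w₀-injective {x = x} {y} e = ≡.trans (≡.sym (opposite-involutive x)) (≡.trans (cong opposite e) (opposite-involutive y))

SwapClosed : ∀ {p} → (List (Fin n) → Set p) → Set p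
SwapClosed Adm = ∀ P a b Q → b Fin.< a → Adm (P ++ a ∷ b ∷ Q) → Adm (P ++ b ∷ a ∷ Q)

infix 4 _⇄_

data _⇄_ {A : Set a} : List A → List A → Set a where
  here  : ∀ x y xs → x ∷ y ∷ xs ⇄ y ∷ x ∷ xs
  there : ∀ x {xs ys} → xs ⇄ ys → x ∷ xs ⇄ x ∷ ys

⇄-at : ∀ P (x y : A) Q → P ++ x ∷ y ∷ Q ⇄ P ++ y ∷ x ∷ Q
⇄-at []      x y Q = here x y Q
⇄-at (p ∷ P) x y Q = there p (⇄-at P x y Q)

⇄-++ˡ : ∀ W {xs ys : List A} → xs ⇄ ys → W ++ xs ⇄ W ++ ys
⇄-++ˡ []      p = p
⇄-++ˡ (w ∷ W) p = there w (⇄-++ˡ W p)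

⇄-++ʳ : ∀ {xs ys : List A} Z → xs ⇄ ys → xs ++ Z ⇄ ys ++ Z
⇄-++ʳ Z (here x y xs) = here x y (xs ++ Z)
⇄-++ʳ Z (there x p)   = there x (⇄-++ʳ Z p)

⇄⇒↭ : {xs ys : List A} → xs ⇄ ys → xs ↭ ys
⇄⇒↭ (here x y xs) = ↭.swap x y ↭-refl
⇄⇒↭ (there x p)   = ↭.prep x (⇄⇒↭ p)

transposition-↭ : ∀ X (x : A) Y y Z → X ++ x ∷ Y ++ y ∷ Z ↭ X ++ y ∷ Y ++ x ∷ Z
transposition-↭ X x Y y Z =
  ++⁺ˡ X (↭-trans (↭.prep x (shift y Y Z)) (↭-trans (↭.swap x y ↭-refl) (↭.prep y (↭-sym (shift x Y Z)))))

Unique-resp-↭ : {xs ys : List A} → xs ↭ ys → Unique xs → Unique ys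
Unique-resp-↭ p = ↭ₛ.Unique-resp-↭ (≡.setoid _) (↭⇒↭ₛ p)

Unique-middle : ∀ X {x : A} {Y} → Unique (X ++ x ∷ Y) → All (x ≢_) (X ++ Y)
Unique-middle X {x} {Y} u with x≢ ∷ _ ← Unique-resp-↭ (shift x X Y) u = x≢

Unique-⊆-⊇⇒↭ : {xs ys : List A} → Unique xs → Unique ys →
               (∀ {z} → z ∈ xs → z ∈ ys) → (∀ {z} → z ∈ ys → z ∈ xs) → xs ↭ ys
Unique-⊆-⊇⇒↭ {xs = []}     {[]}     _ _ _ _ = ↭-refl
Unique-⊆-⊇⇒↭ {xs = []}     {y ∷ _}  _ _ _ ⊇ with () ← ⊇ (here refl)
Unique-⊆-⊇⇒↭ {xs = x ∷ xs} {ys} (x∉xs ∷ xs!) ys! ⊆ ⊇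
  with ys₁ , ys₂ , refl ← ∈-∃++ (⊆ (here refl))
  with x∉ys′ ∷ ys′! ← Unique-resp-↭ (shift x ys₁ ys₂) ys! =
  ↭-trans (↭.prep x (Unique-⊆-⊇⇒↭ xs! ys′! ⊆′ ⊇′)) (↭-sym σ)
  where
  σ = shift x ys₁ ys₂
  ⊆′ : ∀ {z} → z ∈ xs → z ∈ ys₁ ++ ys₂
  ⊆′ z∈xs with ∈-resp-↭ σ (⊆ (there z∈xs))
  ... | here refl   = ⊥-elim (All.lookup x∉xs z∈xs refl)
  ... | there z∈ys′ = z∈ys′
  ⊇′ : ∀ {z} → z ∈ ys₁ ++ ys₂ → z ∈ xs
  ⊇′ z∈ys′ with ⊇ (∈-resp-↭ (↭-sym σ) (there z∈ys′))
  ... | here refl  = ⊥-elim (All.lookup x∉ys′ z∈ys′ refl)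
  ... | there z∈xs = z∈xs

entries : (Fin d → Maybe A) → List A
entries {d = zero}  g = []
entries {d = suc d} g = maybe′ _∷_ id (g Fin.zero) (entries (g ∘ Fin.suc))

mapMaybe-allFin : (g : Fin d → Maybe A) → mapMaybe g (allFin d) ≡ entries g
mapMaybe-allFin {d = zero}  g = refl
mapMaybe-allFin {d = suc d} g =
  ≡.trans (cong List.catMaybes (map-allFin-suc g))
          (cong (maybe′ _∷_ id (g Fin.zero)) (mapMaybe-allFin (g ∘ Fin.suc)))

entries-cong : {g h : Fin d → Maybe A} → (∀ j → g j ≡ h j) → entries g ≡ entries h
entries-cong {d = zero}  g=h = refl
entries-cong {d = suc d} g=h = cong₂ (maybe′ _∷_ id) (g=h Fin.zero) (entries-cong (g=h ∘ Fin.suc))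

entries-map : ∀ {b} {B : Set b} (f : A → B) (g : Fin d → Maybe A) → entries (Maybe.map f ∘ g) ≡ map f (entries g)
entries-map {d = zero}  f g = refl
entries-map {d = suc d} f g with g Fin.zero
... | just x  = cong (f x ∷_) (entries-map f (g ∘ Fin.suc))
... | nothing = entries-map f (g ∘ Fin.suc)

word : Array N d n → List (Fin n)
word {N = zero}  t = []
word {N = suc N} t = entries (t Fin.zero) ++ word (t ∘ Fin.suc)

readingWord≡word : (t : Array N d n) → readingWord t ≡ word t
readingWord≡word {N = zero}  t = refl
readingWord≡word {N = suc N} t =
  ≡.trans (cong List.concat (map-allFin-suc (λ i → mapMaybe (t i) (allFin _))))
          (cong₂ _++_ (mapMaybe-allFin (t Fin.zero)) (readingWord≡word (t ∘ Fin.suc)))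

column : Array N d n → Fin d → List (Fin n)
column t j = entries (λ i → t i j)

_≐_ : Array N d n → Array N d n → Set
t ≐ t′ = ∀ i j → t i j ≡ t′ i j

word-cong : {t t′ : Array N d n} → t ≐ t′ → word t ≡ word t′
word-cong {N = zero}  t=t′ = refl
word-cong {N = suc N} t=t′ = cong₂ _++_ (entries-cong (t=t′ Fin.zero)) (word-cong (t=t′ ∘ Fin.suc))

word-map : (w : Fin n → Fin n) (t : Array N d n) → word (λ i j → Maybe.map w (t i j)) ≡ map w (word t)
word-map {N = zero}  w t = refl
word-map {N = suc N} w t =
  ≡.trans (cong₂ _++_ (entries-map w (t Fin.zero)) (word-map w (t ∘ Fin.suc)))
          (≡.sym (map-++ w (entries (t Fin.zero)) (word (t ∘ Fin.suc))))

Shape : ℕ → ℕ → Set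
Shape N d = Fin N → Fin d → Bool

shape : Array N d n → Shape N d
shape t i j = is-just (t i j)

Columns : ℕ → ℕ → Set
Columns d n = Fin d → List (Fin n)

pop : Shape (suc N) d → Columns d n → Columns d n
pop S c j = if S Fin.zero j then List.drop 1 (c j) else c j

-- fill S c writes each list c j, top to bottom, into the cells of column j that S marks.
fill : Shape N d → Columns d n → Array N d n
fill {N = suc N} S c Fin.zero    j = if S Fin.zero j then List.head (c j) else nothing
fill {N = suc N} S c (Fin.suc i) j = fill (S ∘ Fin.suc) (pop S c) i j

height : Shape N d → Fin d → ℕ
height {N = zero}  S j = 0
height {N = suc N} S j = (if S Fin.zero j then 1 else 0) ℕ.+ height (S ∘ Fin.suc) j

fill-cong : (S : Shape N d) {c c′ : Columns d n} → (∀ j → c j ≡ c′ j) → fill S c ≐ fill S c′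
fill-cong {N = suc N} S c=c′ Fin.zero    j rewrite c=c′ j = refl
fill-cong {N = suc N} S c=c′ (Fin.suc i) j =
  fill-cong (S ∘ Fin.suc) (λ j′ → cong (λ L → if S Fin.zero j′ then List.drop 1 L else L) (c=c′ j′)) i j

fill-congˢ : {S S′ : Shape N d} (c : Columns d n) → (∀ i j → S i j ≡ S′ i j) → fill S c ≐ fill S′ c
fill-congˢ {N = suc N} c S=S′ Fin.zero    j rewrite S=S′ Fin.zero j = refl
fill-congˢ {N = suc N} {S = S} {S′} c S=S′ (Fin.suc i) j =
  ≡.trans (fill-cong (S ∘ Fin.suc) (λ j′ → cong (λ b → if b then List.drop 1 (c j′) else c j′) (S=S′ Fin.zero j′)) i j)
          (fill-congˢ (pop S′ c) (S=S′ ∘ Fin.suc) i j)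

shape-fill : (S : Shape N d) (c : Columns d n) → (∀ j → height S j ℕ.≤ length (c j)) →
             ∀ i j → shape (fill S c) i j ≡ S i j
shape-fill {N = suc N} S c fits Fin.zero j with S Fin.zero j | c j | fits j
... | true  | _ ∷ _ | _ = refl
... | false | _     | _ = refl
shape-fill {N = suc N} S c fits (Fin.suc i) j = shape-fill (S ∘ Fin.suc) (pop S c) fits′ i j
  where
  fits′ : ∀ j → height (S ∘ Fin.suc) j ℕ.≤ length (pop S c j)
  fits′ j with S Fin.zero j | c j | fits j
  ... | true  | _ ∷ _ | s≤s h≤l = h≤l
  ... | false | _     | h≤l     = h≤l

column-fill : (S : Shape N d) (c : Columns d n) (j : Fin d) → height S j ≡ length (c j) → column (fill S c) j ≡ c j
column-fill {N = zero}  S c j h=l with c j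
... | [] = refl
column-fill {N = suc N} S c j h=l with S Fin.zero j in Sj | c j in cj
... | true  | x ∷ L = cong (x ∷_) (≡.trans (column-fill (S ∘ Fin.suc) (pop S c) j h=l′) pop-c)
  where
  pop-c : pop S c j ≡ L
  pop-c rewrite Sj | cj = refl
  h=l′ = ≡.trans (ℕ.suc-injective h=l) (cong length (≡.sym pop-c))
... | false | L = ≡.trans (column-fill (S ∘ Fin.suc) (pop S c) j h=l′) pop-c
  where
  pop-c : pop S c j ≡ L
  pop-c rewrite Sj | cj = refl
  h=l′ = ≡.trans h=l (cong length (≡.sym pop-c))

fill-shape : (t : Array N d n) {c : Columns d n} → (∀ j → column t j ≡ c j) → fill (shape t) c ≐ t
fill-shape {N = suc N} t {c} t=c Fin.zero j with t Fin.zero j | c j | t=c j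
... | just _  | _ | refl = refl
... | nothing | _ | refl = refl
fill-shape {N = suc N} t {c} t=c (Fin.suc i) j = fill-shape (t ∘ Fin.suc) t=c′ i j
  where
  t=c′ : ∀ j → column (t ∘ Fin.suc) j ≡ pop (shape t) c j
  t=c′ j with t Fin.zero j | c j | t=c j
  ... | just _  | _ | refl = refl
  ... | nothing | _ | refl = refl

height-shape : (t : Array N d n) (j : Fin d) → height (shape t) j ≡ length (column t j)
height-shape {N = zero}  t j = refl
height-shape {N = suc N} t j with t Fin.zero j
... | just _  = cong suc (height-shape (t ∘ Fin.suc) j)
... | nothing = height-shape (t ∘ Fin.suc) j

fill-map : (w : Fin n → Fin n) (S : Shape N d) (c : Columns d n) →
           fill S (map w ∘ c) ≐ (λ i j → Maybe.map w (fill S c i j))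
fill-map {N = suc N} w S c Fin.zero j with S Fin.zero j | c j
... | true  | []    = refl
... | true  | _ ∷ _ = refl
... | false | _     = refl
fill-map {N = suc N} w S c (Fin.suc i) j =
  ≡.trans (fill-cong (S ∘ Fin.suc) pop-map i j) (fill-map w (S ∘ Fin.suc) (pop S c) i j)
  where
  pop-map : ∀ j → pop S (map w ∘ c) j ≡ map w (pop S c j)
  pop-map j with S Fin.zero j | c j
  ... | true  | []    = refl
  ... | true  | _ ∷ _ = refl
  ... | false | _     = refl

sortColumns : List (Fin d) → Columns d n → Columns d n
sortColumns []       c = c
sortColumns (j ∷ js) c = updateAt (sortColumns js c) j (const (sort (sortColumns js c j)))

sortColumns-↭ : ∀ js (c : Columns d n) j → sortColumns js c j ↭ c j
sortColumns-↭ []       c j = ↭-refl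
sortColumns-↭ (j′ ∷ js) c j with j ≟ j′
... | yes refl = ↭-trans (↭-reflexive (updateAt-updates j (sortColumns js c)))
                         (↭-trans (sort-↭ (sortColumns js c j)) (sortColumns-↭ js c j))
... | no j≢j′  = ↭-trans (↭-reflexive (updateAt-minimal j j′ (sortColumns js c) j≢j′)) (sortColumns-↭ js c j)

sortColumns-sorted : ∀ js (c : Columns d n) {j} → j ∈ js → Sorted (sortColumns js c j)
sortColumns-sorted (j′ ∷ js) c {j} j∈ with j ≟ j′ | j∈
... | yes refl | _          = subst Sorted (≡.sym (updateAt-updates j (sortColumns js c))) (sort-↗ (sortColumns js c j))
... | no j≢j′  | here j=j′  = ⊥-elim (j≢j′ j=j′)
... | no j≢j′  | there j∈js =
  subst Sorted (≡.sym (updateAt-minimal j j′ (sortColumns js c) j≢j′)) (sortColumns-sorted js c j∈js)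

sortColumns-allFin : (c : Columns d n) (j : Fin d) → sortColumns (allFin d) c j ≡ sort (c j)
sortColumns-allFin c j =
  Sorted⇒≡ (sortColumns-sorted (allFin _) c (∈-allFin j)) (sort-↗ (c j))
           (↭-trans (sortColumns-↭ (allFin _) c j) (↭-sym (sort-↭ (c j))))

AgreeOff : ∀ {b} {B : Set b} → Fin d → (Fin d → B) → (Fin d → B) → Set b
AgreeOff j f g = ∀ j′ → j′ ≢ j → f j′ ≡ g j′

agree-everywhere : ∀ {b} {B : Set b} {j : Fin d} {f g : Fin d → B} → AgreeOff j f g → f j ≡ g j → ∀ j′ → f j′ ≡ g j′
agree-everywhere {j = j} agree fj=gj j′ with j′ ≟ j
... | yes refl = fj=gj
... | no  j′≢j = agree j′ j′≢j

module _ (S : Shape (suc N) d) {c c′ : Columns d n} {j : Fin d} (agree : AgreeOff j c c′) where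

  pop-agree : AgreeOff j (pop S c) (pop S c′)
  pop-agree j′ j′≢j rewrite agree j′ j′≢j = refl

  row₀-agree : AgreeOff j (fill S c Fin.zero) (fill S c′ Fin.zero)
  row₀-agree j′ j′≢j rewrite agree j′ j′≢j = refl

entries-swap : {g g′ : Fin d → Maybe A} {j : Fin d} {x y : A} →
               AgreeOff j g g′ → g j ≡ just x → g′ j ≡ just y →
               ∃₂ λ U V → entries g ≡ U ++ x ∷ V × entries g′ ≡ U ++ y ∷ V
entries-swap {d = suc d} {g = g} {g′} {Fin.zero} agree gj g′j rewrite gj | g′j =
  [] , entries (g ∘ Fin.suc) , refl , cong (_ ∷_) (entries-cong (λ j′ → ≡.sym (agree (Fin.suc j′) λ ())))
entries-swap {d = suc d} {g = g} {g′} {Fin.suc j} agree gj g′j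
  with U , V , e , e′ ← entries-swap (λ j′ j′≢j → agree (Fin.suc j′) (j′≢j ∘ Fin.suc-injective)) gj g′j
  with g Fin.zero | g′ Fin.zero | agree Fin.zero (λ ())
... | just z  | _ | refl = z ∷ U , V , cong (z ∷_) e , cong (z ∷_) e′
... | nothing | _ | refl = U , V , e , e′

++-prepend-split : ∀ (R : List A) {X Z x} {w : List A} → w ≡ X ++ x ∷ Z → R ++ w ≡ (R ++ X) ++ x ∷ Z
++-prepend-split R {X} w= = ≡.trans (cong (R ++_) w=) (≡.sym (++-assoc R X _))

module _ (S : Shape (suc N) d) (c : Columns d n) {j : Fin d} where

  row₀-filled : ∀ {x L} → S Fin.zero j ≡ true → c j ≡ x ∷ L → fill S c Fin.zero j ≡ just x × pop S c j ≡ L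
  row₀-filled Sj cj rewrite Sj | cj = refl , refl

  row₀-empty : S Fin.zero j ≡ false → fill S c Fin.zero j ≡ nothing × pop S c j ≡ c j
  row₀-empty Sj rewrite Sj = refl , refl

fill-head-swap : (S : Shape N d) {c c′ : Columns d n} {j : Fin d} {x y : Fin n} {L : List (Fin n)} →
  AgreeOff j c c′ → c j ≡ x ∷ L → c′ j ≡ y ∷ L → 1 ℕ.≤ height S j →
  ∃₂ λ X Z → word (fill S c) ≡ X ++ x ∷ Z × word (fill S c′) ≡ X ++ y ∷ Z
fill-head-swap {N = suc N} S {c} {c′} {j} agree cj c′j h with S Fin.zero j in Sj
... | true
  with cell , popc ← row₀-filled S c Sj cj
  with cell′ , popc′ ← row₀-filled S c′ Sj c′j
  with U , V , e , e′ ← entries-swap (row₀-agree S agree) cell cell′ =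
  U , V ++ word (fill (S ∘ Fin.suc) (pop S c)) ,
  ≡.trans (cong (_++ _) e) (++-assoc U _ _) ,
  ≡.trans (cong₂ _++_ e′ (word-cong (fill-cong (S ∘ Fin.suc) (≡.sym ∘ rest))))
          (++-assoc U _ _)
  where rest = agree-everywhere (pop-agree S agree) (≡.trans popc (≡.sym popc′))
... | false
  with cell , popc ← row₀-empty S c Sj
  with cell′ , popc′ ← row₀-empty S c′ Sj
  with X , Z , e , e′ ← fill-head-swap (S ∘ Fin.suc) (pop-agree S agree) (≡.trans popc cj) (≡.trans popc′ c′j) h =
  entries (fill S c Fin.zero) ++ X , Z , ++-prepend-split _ e ,
  ≡.trans (cong (_++ _) (entries-cong (≡.sym ∘ row₀))) (++-prepend-split _ e′)
  where row₀ = agree-everywhere (row₀-agree S agree) (≡.trans cell (≡.sym cell′))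

fill-swap : (S : Shape N d) {c c′ : Columns d n} {j : Fin d} (P : List (Fin n)) (a b : Fin n) (Q : List (Fin n)) →
  AgreeOff j c c′ → c j ≡ P ++ a ∷ b ∷ Q → c′ j ≡ P ++ b ∷ a ∷ Q → suc (suc (length P)) ℕ.≤ height S j →
  ∃₂ λ X Y → ∃ λ Z → word (fill S c) ≡ X ++ a ∷ Y ++ b ∷ Z × word (fill S c′) ≡ X ++ b ∷ Y ++ a ∷ Z
fill-swap {N = suc N} S {c} {c′} {j} P a b Q agree cj c′j h with S Fin.zero j in Sj
... | false
  with cell , popc ← row₀-empty S c Sj
  with cell′ , popc′ ← row₀-empty S c′ Sj
  with X , Y , Z , e , e′ ← fill-swap (S ∘ Fin.suc) P a b Q (pop-agree S agree) (≡.trans popc cj) (≡.trans popc′ c′j) h =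
  entries (fill S c Fin.zero) ++ X , Y , Z , ++-prepend-split _ e ,
  ≡.trans (cong (_++ _) (entries-cong (≡.sym ∘ row₀))) (++-prepend-split _ e′)
  where row₀ = agree-everywhere (row₀-agree S agree) (≡.trans cell (≡.sym cell′))
fill-swap {N = suc N} S {c} {c′} {j} (p ∷ P′) a b Q agree cj c′j h | true
  with cell , popc ← row₀-filled S c Sj cj
  with cell′ , popc′ ← row₀-filled S c′ Sj c′j
  with X , Y , Z , e , e′ ← fill-swap (S ∘ Fin.suc) P′ a b Q (pop-agree S agree) popc popc′ (ℕ.≤-pred h) =
  entries (fill S c Fin.zero) ++ X , Y , Z , ++-prepend-split _ e ,
  ≡.trans (cong (_++ _) (entries-cong (≡.sym ∘ row₀))) (++-prepend-split _ e′)
  where row₀ = agree-everywhere (row₀-agree S agree) (≡.trans cell (≡.sym cell′))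
fill-swap {N = suc N} S {c} {c′} {j} [] a b Q agree cj c′j h | true
  with cell , popc ← row₀-filled S c Sj cj
  with cell′ , popc′ ← row₀-filled S c′ Sj c′j
  with U , V , e₀ , e₀′ ← entries-swap (row₀-agree S agree) cell cell′
  with X , Z , e , e′ ← fill-head-swap (S ∘ Fin.suc) (pop-agree S agree) popc popc′ (ℕ.≤-pred h) =
  U , V ++ X , Z , ≡.trans (cong₂ _++_ e₀ e) (splice U V X) , ≡.trans (cong₂ _++_ e₀′ e′) (splice U V X)
  where
  splice : ∀ U V X {x y Z} → (U ++ x ∷ V) ++ (X ++ y ∷ Z) ≡ U ++ x ∷ (V ++ X) ++ y ∷ Z
  splice U V X = ≡.trans (++-assoc U _ _) (cong (λ L → U ++ _ ∷ L) (≡.sym (++-assoc V X _)))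

concatCols : Columns d n → List (Fin n)
concatCols {d = zero}  c = []
concatCols {d = suc d} c = c Fin.zero ++ concatCols (c ∘ Fin.suc)

concatCols-empty : (c : Columns d n) → (∀ j → 0 ≡ length (c j)) → concatCols c ≡ []
concatCols-empty {d = zero}  c _ = refl
concatCols-empty {d = suc d} c empty with c Fin.zero | empty Fin.zero
... | [] | _ = concatCols-empty (c ∘ Fin.suc) (empty ∘ Fin.suc)

entries-concatCols : {g : Fin d → Maybe (Fin n)} {c c′ : Columns d n} →
                     (∀ j → c j ≡ maybe′ _∷_ id (g j) (c′ j)) → entries g ++ concatCols c′ ↭ concatCols c
entries-concatCols {d = zero}  _ = ↭-refl
entries-concatCols {d = suc d} {g = g} {c} {c′} c=g∷c′ with g Fin.zero | c=g∷c′ Fin.zero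
... | nothing | c₀ rewrite c₀ =
  ↭-trans (shifts (entries (g ∘ Fin.suc)) (c′ Fin.zero)) (++⁺ˡ (c′ Fin.zero) (entries-concatCols (c=g∷c′ ∘ Fin.suc)))
... | just x  | c₀ rewrite c₀ =
  ↭.prep x (↭-trans (shifts (entries (g ∘ Fin.suc)) (c′ Fin.zero)) (++⁺ˡ (c′ Fin.zero) (entries-concatCols (c=g∷c′ ∘ Fin.suc))))

word-fill-↭ : (S : Shape N d) (c : Columns d n) → (∀ j → height S j ≡ length (c j)) → word (fill S c) ↭ concatCols c
word-fill-↭ {N = zero}  S c h rewrite concatCols-empty c h = ↭-refl
word-fill-↭ {N = suc N} S c h =
  ↭-trans (++⁺ˡ (entries (fill S c Fin.zero)) (word-fill-↭ (S ∘ Fin.suc) (pop S c) h′)) (entries-concatCols split)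
  where
  h′ : ∀ j → height (S ∘ Fin.suc) j ≡ length (pop S c j)
  h′ j with S Fin.zero j | c j | h j
  ... | true  | _ ∷ _ | e = ℕ.suc-injective e
  ... | false | _     | e = e
  split : ∀ j → c j ≡ maybe′ _∷_ id (fill S c Fin.zero j) (pop S c j)
  split j with S Fin.zero j | c j | h j
  ... | true  | _ ∷ _ | _ = refl
  ... | false | _     | _ = refl

-- Blocks and jellyfish tableaux

module _ (B : Blocks n d) (j : Fin d) where

  ∈-elems⁺ : ∀ {x} → T (B j x) → x ∈ elems B j
  ∈-elems⁺ {x} Bjx = ∈-filter⁺ (T? ∘ B j) (∈-allFin x) Bjx

  ∈-elems⁻ : ∀ {x} → x ∈ elems B j → T (B j x)
  ∈-elems⁻ = proj₂ ∘ ∈-filter⁻ (T? ∘ B j) {xs = allFin n}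

  elems-unique : Unique (elems B j)
  elems-unique = Uniqueₚ.filter⁺ (T? ∘ B j) (Uniqueₚ.allFin⁺ n)

  elems-sorted : Sorted (elems B j)
  elems-sorted = Sortedₚ.filter⁺ (≤-totalOrder n) (T? ∘ B j) (allFin-sorted n)

module _ {w : Fin n → Fin n} (w-injective : ∀ {x y} → w x ≡ w y → x ≡ y) (B : Blocks n d) (j : Fin d) where

  elems-act-↭ : elems (act w B) j ↭ map w (elems B j)
  elems-act-↭ = Unique-⊆-⊇⇒↭ (elems-unique (act w B) j) (Uniqueₚ.map⁺ w-injective (elems-unique B j)) ⊆ ⊇
    where
    ⊆ : ∀ {z} → z ∈ elems (act w B) j → z ∈ map w (elems B j)
    ⊆ z∈ with Any.satisfied (Anyₚ.any⁻ _ (allFin n) (∈-elems⁻ (act w B) j z∈))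
    ... | b , Bjb∧wb=z with Bjb , wb=z ← Equivalence.to (T-∧ {B j b}) Bjb∧wb=z =
      subst (_∈ _) (=ᶠ⇒≡ wb=z) (∈-map⁺ w (∈-elems⁺ B j Bjb))
    ⊇ : ∀ {z} → z ∈ map w (elems B j) → z ∈ elems (act w B) j
    ⊇ z∈ with b , b∈ , refl ← ∈-map⁻ w z∈ =
      ∈-elems⁺ (act w B) j (Anyₚ.any⁺ _ (lose (∈-allFin b) (Equivalence.from T-∧ (∈-elems⁻ B j b∈ , ≡⇒=ᶠ {x = w b} refl))))

  sort-map-elems : sort (map w (elems B j)) ≡ elems (act w B) j
  sort-map-elems = Sorted⇒≡ (sort-↗ (map w (elems B j))) (elems-sorted (act w B) j) (↭-trans (sort-↭ _) (↭-sym elems-act-↭))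

  length-elems-act : length (elems (act w B) j) ≡ length (elems B j)
  length-elems-act = ≡.trans (↭-length elems-act-↭) (length-map w (elems B j))

∈-concatCols⁺ : (c : Columns d n) {x : Fin n} (j : Fin d) → x ∈ c j → x ∈ concatCols c
∈-concatCols⁺ {d = suc d} c Fin.zero    x∈ = ∈-++⁺ˡ x∈
∈-concatCols⁺ {d = suc d} c (Fin.suc j) x∈ = ∈-++⁺ʳ (c Fin.zero) (∈-concatCols⁺ (c ∘ Fin.suc) j x∈)

∈-concatCols⁻ : (c : Columns d n) {x : Fin n} → x ∈ concatCols c → ∃ λ j → x ∈ c j
∈-concatCols⁻ {d = suc d} c x∈ with ∈-++⁻ (c Fin.zero) x∈
... | inj₁ x∈c₀ = Fin.zero , x∈c₀
... | inj₂ x∈cs with j , x∈cⱼ ← ∈-concatCols⁻ (c ∘ Fin.suc) x∈cs = Fin.suc j , x∈cⱼ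

concatCols-unique : (c : Columns d n) → (∀ j → Unique (c j)) →
                    (∀ {x} j j′ → x ∈ c j → x ∈ c j′ → j ≡ j′) → Unique (concatCols c)
concatCols-unique {d = zero}  c _ _ = []
concatCols-unique {d = suc d} c c! disjoint =
  Uniqueₚ.++⁺ (c! Fin.zero)
             (concatCols-unique (c ∘ Fin.suc) (c! ∘ Fin.suc) λ j j′ x∈ x∈′ → Fin.suc-injective (disjoint _ _ x∈ x∈′))
             λ (x∈c₀ , x∈cs) → let j , x∈cⱼ = ∈-concatCols⁻ (c ∘ Fin.suc) x∈cs in
                              case disjoint Fin.zero (Fin.suc j) x∈c₀ x∈cⱼ of λ ()

blocks-↭-allFin : (π : Fin n → Fin d) → concatCols (elems (blocksOf π)) ↭ allFin n
blocks-↭-allFin {n = n} π =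
  Unique-⊆-⊇⇒↭ (concatCols-unique _ (elems-unique B) disjoint) (Uniqueₚ.allFin⁺ n)
               (λ {x} _ → ∈-allFin x)
               (λ {x} _ → ∈-concatCols⁺ (elems B) (π x) (∈-elems⁺ B (π x) (≡⇒=ᶠ {x = π x} refl)))
  where
  B = blocksOf π
  disjoint : ∀ {x} j j′ → x ∈ elems B j → x ∈ elems B j′ → j ≡ j′
  disjoint {x} j j′ x∈ x∈′ =
    ≡.trans (≡.sym (=ᶠ⇒≡ {x = π x} (∈-elems⁻ B j x∈))) (=ᶠ⇒≡ {x = π x} (∈-elems⁻ B j′ x∈′))

rowsOK : ℕ → Shape N d → Bool
rowsOK {N = N} {d = d} r S =
  all (λ i → if toℕ i <ᵇ r then all (S i) (allFin d) else (length (filterᵇ (S i) (allFin d)) ≡ᵇ 1)) (allFin N)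

rowsOK-cong : ∀ r {S S′ : Shape N d} → (∀ i j → S i j ≡ S′ i j) → rowsOK r S ≡ rowsOK r S′
rowsOK-cong {N = N} {d = d} r {S} {S′} S=S′ = cong and (List.map-cong row (allFin N))
  where
  row = λ i → cong₂ (if_then_else_ (toℕ i <ᵇ r))
                    (cong and (List.map-cong (S=S′ i) (allFin d)))
                    (cong (λ L → length L ≡ᵇ 1)
                          (List.filter-≐ (T? ∘ S i) (T? ∘ S′ i)
                                         (subst T (S=S′ i _) , subst T (≡.sym (S=S′ i _))) (allFin d)))

jellyfish-columns : ∀ r {B : Blocks n d} (t : Array N d n) → T (isJellyfish r B t) → ∀ j → column t j ≡ elems B j
jellyfish-columns {d = d} r t jt j =
  ≡.trans (≡.sym (mapMaybe-allFin (λ i → t i j)))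
          (listEqᵇ⇒≡ _ _ (All.lookup (Allₚ.all⁺ _ (allFin d) (proj₂ (Equivalence.to T-∧ jt))) (∈-allFin j)))

jellyfish-transfer : ∀ r {B B′ : Blocks n d} {t t′ : Array N d n} → (∀ i j → shape t i j ≡ shape t′ i j) →
                     (∀ j → column t′ j ≡ elems B′ j) → T (isJellyfish r B t) → T (isJellyfish r B′ t′)
jellyfish-transfer {d = d} r {B′ = B′} {t′ = t′} S=S′ cols′ jt =
  Equivalence.from T-∧ (subst T (rowsOK-cong r S=S′) (proj₁ (Equivalence.to T-∧ jt)) ,
                        Allₚ.all⁻ (λ j → listEqᵇ (colEntries t′ j) (elems B′ j)) {xs = allFin d}
                             (All.tabulate λ {j} _ → subst (λ L → T (listEqᵇ L (elems B′ j)))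
                                                           (≡.sym (≡.trans (mapMaybe-allFin (λ i → t′ i j)) (cols′ j)))
                                                           (listEqᵇ-refl (elems B′ j))))

refill : Blocks n d → Array N d n → Array N d n
refill B t = fill (shape t) (elems B)

refill-correspondence : ∀ r {B B′ : Blocks n d} → (∀ j → length (elems B′ j) ≡ length (elems B j)) →
                        {t t′ : Array N d n} → T (isJellyfish r B t) → t′ ≐ refill B′ t →
                        T (isJellyfish r B′ t′) × t ≐ refill B t′
refill-correspondence r {B} {B′} sizes {t} {t′} jt t′=Φt =
  jellyfish-transfer r S=S′ (λ j → ≡.trans (entries-cong (λ i → t′=Φt i j)) (column-fill (shape t) (elems B′) j (heights j))) jt ,
  λ i j → ≡.sym (≡.trans (fill-congˢ (elems B) (λ i j → ≡.sym (S=S′ i j)) i j) (fill-shape t (jellyfish-columns r t jt) i j))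
  where
  heights : ∀ j → height (shape t) j ≡ length (elems B′ j)
  heights j = ≡.trans (height-shape t j) (≡.trans (cong length (jellyfish-columns r t jt j)) (≡.sym (sizes j)))
  S=S′ : ∀ i j → shape t i j ≡ shape t′ i j
  S=S′ i j = ≡.sym (≡.trans (cong is-just (t′=Φt i j)) (shape-fill (shape t) (elems B′) (ℕ.≤-reflexive ∘ heights) i j))

rowsOf-cong : {t t′ : Array N d n} → (∀ i j → shape t i j ≡ shape t′ i j) → ∀ j → rowsOf t j ≡ rowsOf t′ j
rowsOf-cong {N = N} {t = t} {t′} S=S′ j =
  List.filter-≐ (T? ∘ λ i → shape t i j) (T? ∘ λ i → shape t′ i j)
                (subst T (S=S′ _ j) , subst T (≡.sym (S=S′ _ j))) (allFin N)

word-fill-map : (w : Fin n → Fin n) (S : Shape N d) (c : Columns d n) → word (fill S (map w ∘ c)) ≡ map w (word (fill S c))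
word-fill-map w S c = ≡.trans (word-cong (fill-map w S c)) (word-map w (fill S c))

jellyfish-word-↭ : ∀ r (π : Fin n → Fin d) {t : Array N d n} → T (isJellyfish r (blocksOf π) t) → word t ↭ allFin n
jellyfish-word-↭ r π {t} jt =
  subst (_↭ allFin _) (word-cong (fill-shape t (jellyfish-columns r t jt)))
        (↭-trans (word-fill-↭ (shape t) (elems (blocksOf π)) heights) (blocks-↭-allFin π))
  where
  heights : ∀ j → height (shape t) j ≡ length (elems (blocksOf π) j)
  heights j = ≡.trans (height-shape t j) (cong length (jellyfish-columns r t jt j))

jellyfish-word-unique : ∀ r (π : Fin n → Fin d) {t : Array N d n} → T (isJellyfish r (blocksOf π) t) → Unique (word t)
jellyfish-word-unique {n = n} r π {t} jt = Unique-resp-↭ (↭-sym (jellyfish-word-↭ r π {t} jt)) (Uniqueₚ.allFin⁺ n)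

jellyfish-sort-word : ∀ r (π : Fin n → Fin d) {t : Array N d n} → T (isJellyfish r (blocksOf π) t) → sort (word t) ≡ allFin n
jellyfish-sort-word {n = n} r π {t} jt =
  Sorted⇒≡ (sort-↗ (word t)) (allFin-sorted n) (↭-trans (sort-↭ (word t)) (jellyfish-word-↭ r π {t} jt))

Pointwise : ∀ {r} {k} → (A → A → Set r) → (Fin k → A) → (Fin k → A) → Set r
Pointwise _~_ f g = ∀ i → f i ~ g i

module _ {r : Level} (_~_ : A → A → Set r) (eq? : A → A → Bool) where

  pointwiseᵇ : ∀ {k} → (Fin k → A) → (Fin k → A) → Bool
  pointwiseᵇ {zero}  f g = true
  pointwiseᵇ {suc k} f g = eq? (f Fin.zero) (g Fin.zero) ∧ pointwiseᵇ (f ∘ Fin.suc) (g ∘ Fin.suc)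

  pointwiseᵇ-sound : (∀ {x y} → T (eq? x y) → x ~ y) → ∀ {k} {f g : Fin k → A} → T (pointwiseᵇ f g) → Pointwise _~_ f g
  pointwiseᵇ-sound sound {suc k} {f} {g} fg Fin.zero    = sound (proj₁ (Equivalence.to (T-∧ {eq? (f Fin.zero) (g Fin.zero)}) fg))
  pointwiseᵇ-sound sound {suc k} {f} {g} fg (Fin.suc i) =
    pointwiseᵇ-sound sound (proj₂ (Equivalence.to (T-∧ {eq? (f Fin.zero) (g Fin.zero)}) fg)) i

  pointwiseᵇ-complete : (∀ {x y} → x ~ y → T (eq? x y)) → ∀ {k} {f g : Fin k → A} → Pointwise _~_ f g → T (pointwiseᵇ f g)
  pointwiseᵇ-complete complete {zero}  _    = _
  pointwiseᵇ-complete complete {suc k} f~g = Equivalence.from T-∧ (complete (f~g Fin.zero) , pointwiseᵇ-complete complete (f~g ∘ Fin.suc))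

cellᵇ : Maybe (Fin n) → Maybe (Fin n) → Bool
cellᵇ nothing  nothing  = true
cellᵇ (just x) (just y) = x =ᶠ y
cellᵇ _        _        = false

cellᵇ-sound : {x y : Maybe (Fin n)} → T (cellᵇ x y) → x ≡ y
cellᵇ-sound {x = nothing} {nothing} _   = refl
cellᵇ-sound {x = just x}  {just y}  x=y = cong just (=ᶠ⇒≡ x=y)

cellᵇ-complete : {x y : Maybe (Fin n)} → x ≡ y → T (cellᵇ x y)
cellᵇ-complete {x = nothing} refl = _
cellᵇ-complete {x = just x}  refl = ≡⇒=ᶠ {x = x} refl

arrayᵇ : Array N d n → Array N d n → Bool
arrayᵇ = pointwiseᵇ (Pointwise _≡_) (pointwiseᵇ _≡_ cellᵇ)

arrayᵇ-sound : {t t′ : Array N d n} → T (arrayᵇ t t′) → t ≐ t′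
arrayᵇ-sound = pointwiseᵇ-sound _ _ (pointwiseᵇ-sound _≡_ cellᵇ cellᵇ-sound)

arrayᵇ-complete : {t t′ : Array N d n} → t ≐ t′ → T (arrayᵇ t t′)
arrayᵇ-complete = pointwiseᵇ-complete _ _ (pointwiseᵇ-complete _≡_ cellᵇ cellᵇ-complete)

-- Signs and alternating functions

module _ {c ℓ : Level} (R : CommutativeRing c ℓ) where

  open CommutativeRing R renaming (refl to ≈-refl; sym to ≈-sym; trans to ≈-trans)
  open import Algebra.Properties.Ring ring
    using (-‿involutive; -0#≈0#; -‿distribˡ-*; -‿distribʳ-*; -‿+-comm)
  open import Algebra.Properties.CommutativeSemigroup *-commutativeSemigroup
    using (interchange; x∙yz≈y∙xz; xy∙z≈y∙xz)
  open import Relation.Binary.Reasoning.Setoid setoid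

  private
    sign : ℕ → Carrier
    sign = signPow R

    sign-cong : ∀ {k l} → k ≡ l → sign k ≈ sign l
    sign-cong = reflexive ∘ cong sign

  signPow-+ : ∀ k l → sign (k ℕ.+ l) ≈ sign k * sign l
  signPow-+ zero    l = ≈-sym (*-identityˡ _)
  signPow-+ (suc k) l = ≈-trans (-‿cong (signPow-+ k l)) (-‿distribˡ-* _ _)

  signPow-square : ∀ k → sign k * sign k ≈ 1#
  signPow-square zero    = *-identityˡ _
  signPow-square (suc k) = begin
    - sign k * - sign k    ≈⟨ -‿distribˡ-* _ _ ⟨
    - (sign k * - sign k)  ≈⟨ -‿cong (-‿distribʳ-* _ _) ⟨
    - - (sign k * sign k)  ≈⟨ -‿involutive _ ⟩
    sign k * sign k        ≈⟨ signPow-square k ⟩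
    1#                     ∎

  sign-swap : ∀ {n} P (a b : Fin n) Q → a ≢ b → sign (inv (P ++ b ∷ a ∷ Q)) ≈ - sign (inv (P ++ a ∷ b ∷ Q))
  sign-swap P a b Q a≢b with ℕ.<-cmp (toℕ a) (toℕ b)
  ... | tri< a<b _ _ = sign-cong (inv-swap P b a Q a<b)
  ... | tri≈ _ a=b _ = ⊥-elim (a≢b (toℕ-injective a=b))
  ... | tri> _ _ b<a = ≈-trans (≈-sym (-‿involutive _)) (-‿cong (sign-cong (≡.sym (inv-swap P a b Q b<a))))

  sign-move : ∀ {n} X (a : Fin n) Y Z → All (a ≢_) Y → sign (inv (X ++ a ∷ Y ++ Z)) ≈ sign (length Y) * sign (inv (X ++ Y ++ a ∷ Z))
  sign-move X a []      Z _          = ≈-sym (*-identityˡ _)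
  sign-move X a (y ∷ Y) Z (a≢y ∷ a≢Y) = begin
    sign (inv (X ++ a ∷ y ∷ Y ++ Z))                  ≈⟨ sign-swap X y a (Y ++ Z) (a≢y ∘ ≡.sym) ⟩
    - sign (inv (X ++ y ∷ a ∷ Y ++ Z))                ≈⟨ -‿cong (sign-cong (cong inv (++-assoc X [ y ] _))) ⟨
    - sign (inv ((X ++ [ y ]) ++ a ∷ Y ++ Z))         ≈⟨ -‿cong (sign-move (X ++ [ y ]) a Y Z a≢Y) ⟩
    - (sign (length Y) * sign (inv ((X ++ [ y ]) ++ Y ++ a ∷ Z)))
                                                      ≈⟨ -‿distribˡ-* _ _ ⟩
    sign (suc (length Y)) * sign (inv ((X ++ [ y ]) ++ Y ++ a ∷ Z))
                                                      ≈⟨ *-congˡ (sign-cong (cong inv (++-assoc X [ y ] _))) ⟩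
    sign (suc (length Y)) * sign (inv (X ++ y ∷ Y ++ a ∷ Z)) ∎

  sign-transpose : ∀ {n} X (a : Fin n) Y b Z → Unique (X ++ a ∷ Y ++ b ∷ Z) →
                   sign (inv (X ++ b ∷ Y ++ a ∷ Z)) ≈ - sign (inv (X ++ a ∷ Y ++ b ∷ Z))
  sign-transpose X a Y b Z u = begin
    sign (inv (X ++ b ∷ Y ++ a ∷ Z))                  ≈⟨ sign-move X b Y (a ∷ Z) b≢Y ⟩
    sign (length Y) * sign (inv (X ++ Y ++ b ∷ a ∷ Z)) ≈⟨ *-congˡ (sign-cong (cong inv (++-assoc X Y _))) ⟨
    sign (length Y) * sign (inv ((X ++ Y) ++ b ∷ a ∷ Z))
                                                      ≈⟨ *-congˡ (sign-swap (X ++ Y) a b Z a≢b) ⟩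
    sign (length Y) * - sign (inv ((X ++ Y) ++ a ∷ b ∷ Z))
                                                      ≈⟨ -‿distribʳ-* _ _ ⟨
    - (sign (length Y) * sign (inv ((X ++ Y) ++ a ∷ b ∷ Z)))
                                                      ≈⟨ -‿cong (*-congˡ (sign-cong (cong inv (++-assoc X Y _)))) ⟩
    - (sign (length Y) * sign (inv (X ++ Y ++ a ∷ b ∷ Z)))
                                                      ≈⟨ -‿cong (sign-move X a Y (b ∷ Z) a≢Y) ⟨
    - sign (inv (X ++ a ∷ Y ++ b ∷ Z))                ∎
    where
    a≢Yb = Allₚ.++⁻ʳ X (Unique-middle X u)
    a≢Y = Allₚ.++⁻ˡ Y a≢Yb
    a≢b = All.head (Allₚ.++⁻ʳ Y a≢Yb)
    b≢Y = All.tail (Allₚ.++⁻ʳ X (Allₚ.++⁻ˡ (X ++ a ∷ Y) (Unique-middle (X ++ a ∷ Y) (subst Unique (≡.sym (++-assoc X (a ∷ Y) _)) u))))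

  Alternating : ∀ {n p} → (List (Fin n) → Set p) → (List (Fin n) → Carrier) → Set (p ⊔ ℓ)
  Alternating Adm F = ∀ P a b Q → b Fin.< a → Adm (P ++ a ∷ b ∷ Q) → F (P ++ b ∷ a ∷ Q) ≈ - F (P ++ a ∷ b ∷ Q)

  module _ {n : ℕ} {p : Level} where

    insert-sign : (Adm : List (Fin n) → Set p) (F : List (Fin n) → Carrier) → SwapClosed Adm → Alternating Adm F →
                  ∀ x {S} → Sorted S → Adm (x ∷ S) → Adm (insert x S) × F (x ∷ S) ≈ sign (#smaller x S) * F (insert x S)
    insert-sign Adm F closed alt x {[]}    _  adm = adm , ≈-sym (*-identityˡ _)
    insert-sign Adm F closed alt x {y ∷ S} S↗ adm with toℕ x ℕ.≤ᵇ toℕ y in x≤ᵇy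
    ... | true = adm , ≈-trans (≈-sym (*-identityˡ _)) (*-congʳ (sign-cong (≡.sym (#smaller-≤ x≤S))))
      where x≤S = Linkedₚ.Linked⇒All Fin.≤-trans (ℕ.≤ᵇ⇒≤ (toℕ x) (toℕ y) (subst T (≡.sym x≤ᵇy) _)) S↗
    ... | false =
      let y<x = ℕ.≰⇒> λ x≤y → subst T x≤ᵇy (ℕ.≤⇒≤ᵇ x≤y)
          adm′ , e = insert-sign (Adm ∘ (y ∷_)) (F ∘ (y ∷_)) (closed ∘ (y ∷_)) (alt ∘ (y ∷_))
                                 x (Linked.tail S↗) (closed [] x y S y<x adm)
      in adm′ , (begin
        F (x ∷ y ∷ S)                               ≈⟨ -‿involutive _ ⟨
        - - F (x ∷ y ∷ S)                           ≈⟨ -‿cong (alt [] x y S y<x adm) ⟨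
        - F (y ∷ x ∷ S)                             ≈⟨ -‿cong e ⟩
        - (sign (#smaller x S) * F (y ∷ insert x S)) ≈⟨ -‿distribˡ-* _ _ ⟩
        sign (suc (#smaller x S)) * F (y ∷ insert x S) ≈⟨ *-congʳ (sign-cong (#smaller-< S y<x)) ⟨
        sign (#smaller x (y ∷ S)) * F (y ∷ insert x S) ∎)

    sort-sign : (Adm : List (Fin n) → Set p) (F : List (Fin n) → Carrier) → SwapClosed Adm → Alternating Adm F →
                ∀ L → Adm L → Adm (sort L) × F L ≈ sign (inv L) * F (sort L)
    sort-sign Adm F closed alt []       adm = adm , ≈-sym (*-identityˡ _)
    sort-sign Adm F closed alt (x ∷ xs) adm =
      let adm₁ , e₁ = sort-sign (Adm ∘ (x ∷_)) (F ∘ (x ∷_)) (closed ∘ (x ∷_)) (alt ∘ (x ∷_)) xs adm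
          adm₂ , e₂ = insert-sign Adm F closed alt x (sort-↗ xs) adm₁
      in adm₂ , (begin
        F (x ∷ xs)                                                         ≈⟨ e₁ ⟩
        sign (inv xs) * F (x ∷ sort xs)                                    ≈⟨ *-congˡ e₂ ⟩
        sign (inv xs) * (sign (#smaller x (sort xs)) * F (sort (x ∷ xs)))  ≈⟨ x∙yz≈y∙xz _ _ _ ⟩
        sign (#smaller x (sort xs)) * (sign (inv xs) * F (sort (x ∷ xs)))  ≈⟨ *-assoc _ _ _ ⟨
        sign (#smaller x (sort xs)) * sign (inv xs) * F (sort (x ∷ xs))    ≈⟨ *-congʳ (*-congʳ (sign-cong (#smaller-↭ x (sort-↭ xs)))) ⟩
        sign (#smaller x xs) * sign (inv xs) * F (sort (x ∷ xs))           ≈⟨ *-congʳ (signPow-+ (#smaller x xs) (inv xs)) ⟨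
        sign (inv (x ∷ xs)) * F (sort (x ∷ xs))                            ∎)

  private
    ∑ : List Carrier → Carrier
    ∑ = sumR R

    ∏ : List Carrier → Carrier
    ∏ = prodR R

  𝟙 : Bool → Carrier
  𝟙 true  = 1#
  𝟙 false = 0#

  𝟙-∧ : ∀ x y → 𝟙 (x ∧ y) ≈ 𝟙 x * 𝟙 y
  𝟙-∧ true  y = ≈-sym (*-identityˡ _)
  𝟙-∧ false y = ≈-sym (zeroˡ _)

  𝟙-*-cong : ∀ b {x y} → (T b → x ≈ y) → 𝟙 b * x ≈ 𝟙 b * y
  𝟙-*-cong true  x=y = *-congˡ (x=y _)
  𝟙-*-cong false _   = ≈-trans (zeroˡ _) (≈-sym (zeroˡ _))

  ∑-0 : (xs : List A) → ∑ (map (λ _ → 0#) xs) ≈ 0#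
  ∑-0 []       = ≈-refl
  ∑-0 (x ∷ xs) = ≈-trans (+-identityˡ _) (∑-0 xs)

  ∑-cong : {f g : A → Carrier} → (∀ x → f x ≈ g x) → ∀ xs → ∑ (map f xs) ≈ ∑ (map g xs)
  ∑-cong f=g []       = ≈-refl
  ∑-cong f=g (x ∷ xs) = +-cong (f=g x) (∑-cong f=g xs)

  ∑-filter : (p : A → Bool) (f : A → Carrier) → ∀ xs → ∑ (map f (filterᵇ p xs)) ≈ ∑ (map (λ x → 𝟙 (p x) * f x) xs)
  ∑-filter p f []       = ≈-refl
  ∑-filter p f (x ∷ xs) with p x
  ... | true  = +-cong (≈-sym (*-identityˡ _)) (∑-filter p f xs)
  ... | false = ≈-trans (∑-filter p f xs) (≈-sym (≈-trans (+-congʳ (zeroˡ _)) (+-identityˡ _)))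

  ∑-*ˡ : ∀ k (f : A → Carrier) xs → ∑ (map (λ x → k * f x) xs) ≈ k * ∑ (map f xs)
  ∑-*ˡ k f []       = ≈-sym (zeroʳ k)
  ∑-*ˡ k f (x ∷ xs) = ≈-trans (+-congˡ (∑-*ˡ k f xs)) (≈-sym (distribˡ k _ _))

  ∑-+ : (f g : A → Carrier) → ∀ xs → ∑ (map (λ x → f x + g x) xs) ≈ ∑ (map f xs) + ∑ (map g xs)
  ∑-+ f g []       = ≈-sym (+-identityˡ _)
  ∑-+ f g (x ∷ xs) = ≈-trans (+-congˡ (∑-+ f g xs)) (+-interchange _ _ _ _)
    where open import Algebra.Properties.CommutativeSemigroup +-commutativeSemigroup
            renaming (interchange to +-interchange)

  ∑-map : ∀ {b} {B : Set b} (f : B → Carrier) (h : A → B) xs → ∑ (map f (map h xs)) ≈ ∑ (map (f ∘ h) xs)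
  ∑-map f h xs = reflexive (cong ∑ (≡.sym (List.map-∘ xs)))

  ∑-concatMap : ∀ {b} {B : Set b} (f : B → Carrier) (h : A → List B) xs →
                ∑ (map f (concatMap h xs)) ≈ ∑ (map (λ x → ∑ (map f (h x))) xs)
  ∑-concatMap f h []       = ≈-refl
  ∑-concatMap f h (x ∷ xs) =
    ≈-trans (reflexive (cong ∑ (map-++ f (h x) _))) (≈-trans (∑-++ (map f (h x)) _) (+-congˡ (∑-concatMap f h xs)))
    where
    ∑-++ : ∀ us vs → ∑ (us ++ vs) ≈ ∑ us + ∑ vs
    ∑-++ []       vs = ≈-sym (+-identityˡ _)
    ∑-++ (u ∷ us) vs = ≈-trans (+-congˡ (∑-++ us vs)) (≈-sym (+-assoc _ _ _))

  ∑-comm : ∀ {b} {B : Set b} (g : A → B → Carrier) xs ys →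
           ∑ (map (λ x → ∑ (map (g x) ys)) xs) ≈ ∑ (map (λ y → ∑ (map (λ x → g x y) xs)) ys)
  ∑-comm g []       ys = ≈-sym (∑-0 ys)
  ∑-comm g (x ∷ xs) ys = ≈-trans (+-congˡ (∑-comm g xs ys)) (≈-sym (∑-+ (g x) _ ys))

  ∏-cong : {f g : A → Carrier} → (∀ x → f x ≈ g x) → ∀ xs → ∏ (map f xs) ≈ ∏ (map g xs)
  ∏-cong f=g []       = ≈-refl
  ∏-cong f=g (x ∷ xs) = *-cong (f=g x) (∏-cong f=g xs)

  ∏-allFin-suc : ∀ {d} (f : Fin (suc d) → Carrier) → ∏ (map f (allFin (suc d))) ≈ f Fin.zero * ∏ (map (f ∘ Fin.suc) (allFin d))
  ∏-allFin-suc f = reflexive (cong ∏ (map-allFin-suc f))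

  ∏-negate : ∀ {d} {f g : Fin d → Carrier} j → (∀ j′ → j′ ≢ j → f j′ ≈ g j′) → f j ≈ - g j →
             ∏ (map f (allFin d)) ≈ - ∏ (map g (allFin d))
  ∏-negate {suc d} {f} {g} j f=g fⱼ=-gⱼ = begin
    ∏ (map f (allFin (suc d)))                      ≈⟨ ∏-allFin-suc f ⟩
    f Fin.zero * ∏ (map (f ∘ Fin.suc) (allFin d))   ≈⟨ split j f=g fⱼ=-gⱼ ⟩
    - (g Fin.zero * ∏ (map (g ∘ Fin.suc) (allFin d))) ≈⟨ -‿cong (∏-allFin-suc g) ⟨
    - ∏ (map g (allFin (suc d)))                    ∎
    where
    split : ∀ j → (∀ j′ → j′ ≢ j → f j′ ≈ g j′) → f j ≈ - g j →
            f Fin.zero * ∏ (map (f ∘ Fin.suc) (allFin d)) ≈ - (g Fin.zero * ∏ (map (g ∘ Fin.suc) (allFin d)))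
    split Fin.zero    f=g fⱼ=-gⱼ =
      ≈-trans (*-cong fⱼ=-gⱼ (∏-cong (λ j → f=g (Fin.suc j) λ ()) (allFin d))) (≈-sym (-‿distribˡ-* _ _))
    split (Fin.suc j) f=g fⱼ=-gⱼ =
      ≈-trans (*-cong (f=g Fin.zero λ ()) (∏-negate j (λ j′ j′≢j → f=g (Fin.suc j′) (j′≢j ∘ Fin.suc-injective)) fⱼ=-gⱼ))
              (≈-sym (-‿distribʳ-* _ _))

  -- Alternation of minors

  private
    neg-distrib : ∀ u v w → u * - v + - w ≈ - (u * v + w)
    neg-distrib u v w = ≈-trans (+-congʳ (≈-sym (-‿distribʳ-* u v))) (-‿+-comm _ _)

    neg-exchange : ∀ x y z → x + (- y + - z) ≈ - (y + (- x + z))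
    neg-exchange x y z = ≈-sym (begin
      - (y + (- x + z))      ≈⟨ -‿+-comm _ _ ⟨
      - y + - (- x + z)      ≈⟨ +-congˡ (-‿+-comm _ _) ⟨
      - y + (- - x + - z)    ≈⟨ +-congˡ (+-congʳ (-‿involutive x)) ⟩
      - y + (x + - z)        ≈⟨ +-exchange _ _ _ ⟩
      x + (- y + - z)        ∎)
      where open import Algebra.Properties.CommutativeSemigroup +-commutativeSemigroup
              renaming (x∙yz≈y∙xz to +-exchange)

    neg-head : ∀ s m x → - s * m * x ≈ - (s * m * x)
    neg-head s m x = ≈-trans (*-congʳ (≈-sym (-‿distribˡ-* s m))) (≈-sym (-‿distribˡ-* _ x))

  module _ {n : ℕ} (M : Fin n → Fin n → Carrier) where

    private
      det = minorDet R M
      lap = laplace R M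

    laplace-swapˡ : ∀ i is → (∀ {xs ys} → xs ⇄ ys → det is ys ≈ - det is xs) →
                    ∀ {pre pre′} → pre ⇄ pre′ → ∀ post k → lap i is pre′ post k ≈ - lap i is pre post k
    laplace-swapˡ i is alt p []          k = ≈-sym -0#≈0#
    laplace-swapˡ i is alt p (c′ ∷ post) k =
      ≈-trans (+-cong (*-congˡ (alt (⇄-++ʳ post p))) (laplace-swapˡ i is alt (⇄-++ʳ [ c′ ] p) post (suc k)))
              (neg-distrib _ _ _)

    laplace-swapʳ : ∀ i is → (∀ {xs ys} → xs ⇄ ys → det is ys ≈ - det is xs) →
                    ∀ pre {post post′} → post ⇄ post′ → ∀ k → lap i is pre post′ k ≈ - lap i is pre post k
    laplace-swapʳ i is alt pre (there c p) k =
      ≈-trans (+-cong (*-congˡ (alt (⇄-++ˡ pre p))) (laplace-swapʳ i is alt (pre ++ [ c ]) p (suc k)))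
              (neg-distrib _ _ _)
    laplace-swapʳ i is alt pre (here x y xs) k = begin
      term-y + (- sign k * M i x * det is ((pre ++ [ y ]) ++ xs) + lap i is ((pre ++ [ y ]) ++ [ x ]) xs (2 ℕ.+ k))
        ≈⟨ +-congˡ (+-cong (≈-trans (neg-head _ _ _) (-‿cong (*-congˡ (reflexive (cong (det is) (++-assoc pre [ y ] xs))))))
                           (laplace-swapˡ i is alt x⇄y xs (2 ℕ.+ k))) ⟩
      term-y + (- term-x + - lap i is ((pre ++ [ x ]) ++ [ y ]) xs (2 ℕ.+ k))
        ≈⟨ neg-exchange _ _ _ ⟩
      - (term-x + (- term-y + lap i is ((pre ++ [ x ]) ++ [ y ]) xs (2 ℕ.+ k)))
        ≈⟨ -‿cong (+-congˡ (+-congʳ (≈-trans (neg-head _ _ _) (-‿cong (*-congˡ (reflexive (cong (det is) (++-assoc pre [ x ] xs)))))))) ⟨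
      - (term-x + (- sign k * M i y * det is ((pre ++ [ x ]) ++ xs) + lap i is ((pre ++ [ x ]) ++ [ y ]) xs (2 ℕ.+ k))) ∎
      where
      term-y = sign k * M i y * det is (pre ++ x ∷ xs)
      term-x = sign k * M i x * det is (pre ++ y ∷ xs)
      x⇄y : (pre ++ [ x ]) ++ [ y ] ⇄ (pre ++ [ y ]) ++ [ x ]
      x⇄y = subst₂ _⇄_ (≡.sym (++-assoc pre [ x ] [ y ])) (≡.sym (++-assoc pre [ y ] [ x ])) (⇄-at pre x y [])

    minorDet-alternating : ∀ I {xs ys} → xs ⇄ ys → det I ys ≈ - det I xs
    minorDet-alternating []       (here _ _ _) = ≈-sym -0#≈0#
    minorDet-alternating []       (there _ _)  = ≈-sym -0#≈0#
    minorDet-alternating (i ∷ is) p            = laplace-swapʳ i is (minorDet-alternating is) [] p 0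

    mutual
      minorDet-permCols : ∀ (w : Fin n → Fin n) I J → minorDet R (permCols R w M) I J ≡ det I (map w J)
      minorDet-permCols w []       []      = refl
      minorDet-permCols w []       (_ ∷ _) = refl
      minorDet-permCols w (i ∷ is) J       = laplace-permCols w i is [] J 0

      laplace-permCols : ∀ (w : Fin n → Fin n) i is pre post k →
                         laplace R (permCols R w M) i is pre post k ≡ lap i is (map w pre) (map w post) k
      laplace-permCols w i is pre []         k = refl
      laplace-permCols w i is pre (c′ ∷ post) k =
        cong₂ _+_ (cong (sign k * M i (w c′) *_) (≡.trans (minorDet-permCols w is (pre ++ post)) (cong (det is) (map-++ w pre post))))
                  (≡.trans (laplace-permCols w i is (pre ++ [ c′ ]) post (suc k))
                           (cong (λ pre′ → lap i is pre′ (map w post) (suc k)) (map-++ w pre [ c′ ])))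

  -- Kronecker deltas and changes of variables in sums

  PicksOut : ∀ {a r} {A : Set a} → (A → A → Set r) → (A → A → Bool) → List A → Set (a ⊔ r ⊔ c ⊔ ℓ)
  PicksOut _~_ eq? xs = ∀ t (g : _ → Carrier) → (∀ {x y} → x ~ y → g x ≈ g y) → ∑ (map (λ x → 𝟙 (eq? x t) * g x) xs) ≈ g t

  allFuns-picksOut : ∀ {r} {_~_ : A → A → Set r} {eq? xs} → (∀ x → x ~ x) → PicksOut _~_ eq? xs →
                     ∀ k → PicksOut (Pointwise _~_) (pointwiseᵇ _~_ eq?) (allFuns k xs)
  allFuns-picksOut ~-refl picks zero    t h h-resp = ≈-trans (+-identityʳ _) (≈-trans (*-identityˡ _) (h-resp λ ()))
  allFuns-picksOut {_~_ = _~_} {eq?} {xs} ~-refl picks (suc k) t h h-resp = begin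
    ∑ (map (λ f → 𝟙 (pointwiseᵇ _~_ eq? f t) * h f) (concatMap (λ x → map (x ∷ᶠ_) (allFuns k xs)) xs))
      ≈⟨ ∑-concatMap _ _ xs ⟩
    ∑ (map (λ x → ∑ (map (λ f → 𝟙 (pointwiseᵇ _~_ eq? f t) * h f) (map (x ∷ᶠ_) (allFuns k xs)))) xs)
      ≈⟨ ∑-cong (λ x → ≈-trans (∑-map _ _ (allFuns k xs)) (≈-trans (∑-cong (λ f → split x f) (allFuns k xs)) (∑-*ˡ _ _ (allFuns k xs)))) xs ⟩
    ∑ (map (λ x → 𝟙 (eq? x (t Fin.zero)) * ∑ (map (λ f → 𝟙 (pointwiseᵇ _~_ eq? f (t ∘ Fin.suc)) * h (x ∷ᶠ f)) (allFuns k xs))) xs)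
      ≈⟨ ∑-cong (λ x → *-congˡ (allFuns-picksOut ~-refl picks k (t ∘ Fin.suc) (h ∘ (x ∷ᶠ_))
                                  λ f~g → h-resp λ { Fin.zero → ~-refl x ; (Fin.suc i) → f~g i })) xs ⟩
    ∑ (map (λ x → 𝟙 (eq? x (t Fin.zero)) * h (x ∷ᶠ (t ∘ Fin.suc))) xs)
      ≈⟨ picks (t Fin.zero) (λ x → h (x ∷ᶠ (t ∘ Fin.suc))) (λ x~y → h-resp λ { Fin.zero → x~y ; (Fin.suc i) → ~-refl _ }) ⟩
    h (t Fin.zero ∷ᶠ (t ∘ Fin.suc))
      ≈⟨ h-resp (λ { Fin.zero → ~-refl _ ; (Fin.suc i) → ~-refl _ }) ⟩
    h t ∎
    where
    split : ∀ x f → 𝟙 (pointwiseᵇ _~_ eq? (x ∷ᶠ f) t) * h (x ∷ᶠ f) ≈ 𝟙 (eq? x (t Fin.zero)) * (𝟙 (pointwiseᵇ _~_ eq? f (t ∘ Fin.suc)) * h (x ∷ᶠ f))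
    split x f = ≈-trans (*-congʳ (𝟙-∧ (eq? x (t Fin.zero)) _)) (*-assoc _ _ _)

  cells-picksOut : ∀ {n} → PicksOut _≡_ cellᵇ (nothing ∷ map just (allFin n))
  cells-picksOut {n} nothing  g _ =
    ≈-trans (+-cong (*-identityˡ _) (≈-trans (∑-map _ just (allFin n)) (≈-trans (∑-cong (λ _ → zeroˡ _) (allFin n)) (∑-0 (allFin n)))))
            (+-identityʳ _)
  cells-picksOut {n} (just b) g _ =
    ≈-trans (+-cong (zeroˡ _) (≈-trans (∑-map _ just (allFin n)) (fin-picksOut b (g ∘ just)))) (+-identityˡ _)
    where
    fin-picksOut : ∀ {m} (b : Fin m) (f : Fin m → Carrier) → ∑ (map (λ y → 𝟙 (cellᵇ (just y) (just b)) * f y) (allFin m)) ≈ f b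
    fin-picksOut {suc m} b f = ≈-trans (reflexive (cong ∑ (map-allFin-suc (λ y → 𝟙 (cellᵇ (just y) (just b)) * f y)))) (at b f)
      where
      at : ∀ b (f : Fin (suc m) → Carrier) →
           𝟙 (cellᵇ (just Fin.zero) (just b)) * f Fin.zero + ∑ (map (λ y → 𝟙 (cellᵇ (just (Fin.suc y)) (just b)) * f (Fin.suc y)) (allFin m)) ≈ f b
      at Fin.zero    f = ≈-trans (+-cong (*-identityˡ _) (≈-trans (∑-cong (λ _ → zeroˡ _) (allFin m)) (∑-0 (allFin m)))) (+-identityʳ _)
      at (Fin.suc b) f = ≈-trans (+-cong (zeroˡ _) (fin-picksOut b (f ∘ Fin.suc))) (+-identityˡ _)

  arrays-picksOut : ∀ {N d n} → PicksOut {A = Array N d n} _≐_ arrayᵇ (allArrays N d n)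
  arrays-picksOut {N} {d} = allFuns-picksOut (λ _ _ → refl) (allFuns-picksOut (λ _ → refl) cells-picksOut d) N

  module _ {r : Level} {_~_ : A → A → Set r} {eq? : A → A → Bool} {xs : List A} (picks : PicksOut _~_ eq? xs)
           (sound : ∀ {x y} → T (eq? x y) → x ~ y) (complete : ∀ {x y} → x ~ y → T (eq? x y)) where

    ∑-reindex : (p q : A → Bool) (Φ Ψ : A → A) (g : A → Carrier) → (∀ {x y} → x ~ y → g x ≈ g y) →
                (∀ {x y} → T (p x) → y ~ Φ x → T (q y) × x ~ Ψ y) →
                (∀ {x y} → T (q y) → x ~ Ψ y → T (p x) × y ~ Φ x) →
                ∑ (map (λ x → 𝟙 (p x) * g (Φ x)) xs) ≈ ∑ (map (λ y → 𝟙 (q y) * g y) xs)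
    ∑-reindex p q Φ Ψ g g-resp to from = begin
      ∑ (map (λ x → 𝟙 (p x) * g (Φ x)) xs)
        ≈⟨ ∑-cong (λ x → *-congˡ (picks (Φ x) g g-resp)) xs ⟨
      ∑ (map (λ x → 𝟙 (p x) * ∑ (map (λ y → 𝟙 (eq? y (Φ x)) * g y) xs)) xs)
        ≈⟨ ∑-cong (λ x → ≈-trans (≈-sym (∑-*ˡ _ _ xs)) (∑-cong (λ y → ≈-trans (≈-sym (*-assoc _ _ _))
                                   (*-congʳ (≈-trans (≈-sym (𝟙-∧ (p x) _)) (reflexive (cong 𝟙 (support x y)))))) xs)) xs ⟩
      ∑ (map (λ x → ∑ (map (λ y → 𝟙 (q y ∧ eq? x (Ψ y)) * g y) xs)) xs)
        ≈⟨ ∑-comm (λ x y → 𝟙 (q y ∧ eq? x (Ψ y)) * g y) xs xs ⟩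
      ∑ (map (λ y → ∑ (map (λ x → 𝟙 (q y ∧ eq? x (Ψ y)) * g y) xs)) xs)
        ≈⟨ ∑-cong (λ y → ≈-trans (∑-cong (λ x → ≈-trans (*-congʳ (𝟙-∧ (q y) _)) (xy∙z≈y∙xz _ _ _)) xs)
                                  (picks (Ψ y) (λ _ → 𝟙 (q y) * g y) λ _ → ≈-refl)) xs ⟩
      ∑ (map (λ y → 𝟙 (q y) * g y) xs) ∎
      where
      support : ∀ x y → (p x ∧ eq? y (Φ x)) ≡ (q y ∧ eq? x (Ψ y))
      support x y = T-ext
        (λ h → let px , y~Φx = Equivalence.to (T-∧ {p x}) h ; qy , x~Ψy = to px (sound y~Φx)
               in Equivalence.from T-∧ (qy , complete x~Ψy))
        (λ h → let qy , x~Ψy = Equivalence.to (T-∧ {q y}) h ; px , y~Φx = from qy (sound x~Ψy)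
               in Equivalence.from T-∧ (px , complete y~Φx))

  -- Sorting the columns of a filling

  module _ {N d n : ℕ} (M : Fin n → Fin n → Carrier) (S : Shape N d) (rows : Fin d → List (Fin n)) where

    signOf : Columns d n → Carrier
    signOf c = sign (inv (word (fill S c)))

    minorsOf : Columns d n → Carrier
    minorsOf c = ∏ (map (λ j → minorDet R M (rows j) (c j)) (allFin d))

    Admissible : Columns d n → Set
    Admissible c = (∀ j → height S j ≡ length (c j)) × Unique (word (fill S c))

    weight : Columns d n → Carrier
    weight c = signOf c * minorsOf c

    weight-cong : {c c′ : Columns d n} → (∀ j → c j ≡ c′ j) → weight c ≈ weight c′
    weight-cong c=c′ = *-cong (sign-cong (cong inv (word-cong (fill-cong S c=c′))))
                              (∏-cong (λ j → reflexive (cong (minorDet R M (rows j)) (c=c′ j))) (allFin d))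

    module _ (c : Columns d n) (j : Fin d) where

      private
        _≔_ : Fin d → List (Fin n) → Columns d n
        j ≔ L = updateAt c j (const L)

        ≔-agree : ∀ L L′ → AgreeOff j (j ≔ L) (j ≔ L′)
        ≔-agree L L′ j′ j′≢j = ≡.trans (updateAt-minimal j′ j c j′≢j) (≡.sym (updateAt-minimal j′ j c j′≢j))

        swapped-words : ∀ P a b Q → Admissible (j ≔ (P ++ a ∷ b ∷ Q)) →
          ∃₂ λ X Y → ∃ λ Z → word (fill S (j ≔ (P ++ a ∷ b ∷ Q))) ≡ X ++ a ∷ Y ++ b ∷ Z × word (fill S (j ≔ (P ++ b ∷ a ∷ Q))) ≡ X ++ b ∷ Y ++ a ∷ Z
        swapped-words P a b Q (heights , _) =
          fill-swap S P a b Q (≔-agree _ _) (updateAt-updates j c) (updateAt-updates j c)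
                    (subst (suc (suc (length P)) ℕ.≤_) (≡.sym (≡.trans (heights j) (cong length (updateAt-updates j c)))) (length-≥ P))
          where
          length-≥ : ∀ P → suc (suc (length P)) ℕ.≤ length (P ++ a ∷ b ∷ Q)
          length-≥ []      = s≤s (s≤s z≤n)
          length-≥ (_ ∷ P) = s≤s (length-≥ P)

      Admissible-swap : SwapClosed (Admissible ∘ (j ≔_))
      Admissible-swap P a b Q _ fits@(heights , unique)
        with X , Y , Z , w , w′ ← swapped-words P a b Q fits =
        heights′ , subst Unique (≡.sym w′) (Unique-resp-↭ (transposition-↭ X a Y b Z) (subst Unique w unique))
        where
        heights′ : ∀ j′ → height S j′ ≡ length ((j ≔ (P ++ b ∷ a ∷ Q)) j′)
        heights′ j′ with j′ ≟ j
        ... | yes refl = ≡.trans (heights j) (≡.trans (cong length (updateAt-updates j c))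
                                   (≡.trans (↭-length (⇄⇒↭ (⇄-at P a b Q))) (cong length (≡.sym (updateAt-updates j c)))))
        ... | no j′≢j  = ≡.trans (heights j′) (cong length (≔-agree _ _ j′ j′≢j))

      signOf-alternating : Alternating (Admissible ∘ (j ≔_)) (signOf ∘ (j ≔_))
      signOf-alternating P a b Q _ fits@(_ , unique)
        with X , Y , Z , w , w′ ← swapped-words P a b Q fits =
        ≈-trans (sign-cong (cong inv w′))
                (≈-trans (sign-transpose X a Y b Z (subst Unique w unique)) (-‿cong (sign-cong (cong inv (≡.sym w)))))

      minorsOf-alternating : Alternating (Admissible ∘ (j ≔_)) (minorsOf ∘ (j ≔_))
      minorsOf-alternating P a b Q _ _ =
        ∏-negate j (λ j′ j′≢j → reflexive (cong (minorDet R M (rows j′)) (≔-agree _ _ j′ j′≢j)))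
                   (≈-trans (reflexive (cong (minorDet R M (rows j)) (updateAt-updates j c)))
                            (≈-trans (minorDet-alternating M (rows j) (⇄-at P a b Q))
                                     (-‿cong (reflexive (cong (minorDet R M (rows j)) (≡.sym (updateAt-updates j c)))))))

      sort-column : Admissible c → Admissible (j ≔ sort (c j)) × weight c ≈ weight (j ≔ sort (c j))
      sort-column fits =
        let fits′ , signs  = sort-sign (Admissible ∘ (j ≔_)) (signOf ∘ (j ≔_)) Admissible-swap signOf-alternating (c j) fits₀
            _     , minors = sort-sign (Admissible ∘ (j ≔_)) (minorsOf ∘ (j ≔_)) Admissible-swap minorsOf-alternating (c j) fits₀
        in fits′ , (begin
          signOf c * minorsOf c                                  ≈⟨ weight-cong (≡.sym ∘ unchanged) ⟩
          signOf (j ≔ c j) * minorsOf (j ≔ c j)                  ≈⟨ *-cong signs minors ⟩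
          s * signOf (j ≔ sort (c j)) * (s * minorsOf (j ≔ sort (c j)))  ≈⟨ interchange _ _ _ _ ⟩
          s * s * (signOf (j ≔ sort (c j)) * minorsOf (j ≔ sort (c j))) ≈⟨ *-congʳ (signPow-square (inv (c j))) ⟩
          1# * (signOf (j ≔ sort (c j)) * minorsOf (j ≔ sort (c j)))     ≈⟨ *-identityˡ _ ⟩
          signOf (j ≔ sort (c j)) * minorsOf (j ≔ sort (c j))            ∎)
        where
        s = sign (inv (c j))
        unchanged : ∀ j′ → (j ≔ c j) j′ ≡ c j′
        unchanged j′ with j′ ≟ j
        ... | yes refl = updateAt-updates j c
        ... | no j′≢j  = updateAt-minimal j′ j c j′≢j
        fits₀ : Admissible (j ≔ c j)
        fits₀ = (λ j′ → ≡.trans (proj₁ fits j′) (cong length (≡.sym (unchanged j′)))) ,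
                subst Unique (word-cong (fill-cong S (≡.sym ∘ unchanged))) (proj₂ fits)

    sort-columns : ∀ js (c : Columns d n) → Admissible c →
                   Admissible (sortColumns js c) × weight c ≈ weight (sortColumns js c)
    sort-columns []       c fits = fits , ≈-refl
    sort-columns (j ∷ js) c fits =
      let fits′  , e  = sort-columns js c fits
          fits″ , e′ = sort-column (sortColumns js c) j fits′
      in fits″ , ≈-trans e e′

    sort-all-columns : (c : Columns d n) → Admissible c → weight c ≈ weight (sort ∘ c)
    sort-all-columns c fits = ≈-trans (proj₂ (sort-columns (allFin d) c fits)) (weight-cong (sortColumns-allFin c))

  -- Permuting the columns of the matrix

  sign-inv-map : ∀ {n} {w : Fin n → Fin n} → (∀ {x y} → w x ≡ w y → x ≡ y) → ∀ u → Unique u →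
                 sign (inv (map w u)) ≈ sign (inv u) * sign (inv (map w (sort u)))
  sign-inv-map {w = w} w-injective u u! = proj₂ (sort-sign Unique (λ L → sign (inv (map w L))) swap-unique alternating u u!)
    where
    swap-unique : SwapClosed Unique
    swap-unique P a b Q _ = Unique-resp-↭ (⇄⇒↭ (⇄-at P a b Q))
    alternating : Alternating Unique (λ L → sign (inv (map w L)))
    alternating P a b Q b<a _ =
      ≈-trans (sign-cong (cong inv (map-++ w P (b ∷ a ∷ Q))))
              (≈-trans (sign-swap (map w P) (w a) (w b) (map w Q) (λ wa=wb → ℕ.<⇒≢ b<a (cong toℕ (≡.sym (w-injective wa=wb)))))
                       (-‿cong (sign-cong (cong inv (≡.sym (map-++ w P (a ∷ b ∷ Q)))))))

  module _ {n d : ℕ} (r : ℕ) (π : Fin n → Fin d) {w : Fin n → Fin n} (w-injective : ∀ {x y} → w x ≡ w y → x ≡ y)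
           (M : Fin n → Fin n → Carrier) where

    private
      Tableau : Set
      Tableau = Array (numRows n d r) d n

      B = blocksOf π
      B′ = act w B
      sgn = sign (inv (map w (allFin n)))

      rows : Tableau → Fin d → List (Fin n)
      rows t j = map (λ i → inject≤ i (ℕ.m∸n≤m n ((d ∸ 1) ℕ.* r))) (rowsOf t j)

    summand : (Fin n → Fin n → Carrier) → Blocks n d → Tableau → Carrier
    summand M′ B₀ t = sign (inv (readingWord t)) * Jpoly R M′ r B₀ t

    summand-cong : ∀ B₀ {t t′ : Tableau} → t ≐ t′ → summand M B₀ t ≈ summand M B₀ t′
    summand-cong B₀ {t} {t′} t=t′ =
      *-cong (sign-cong (cong inv (≡.trans (readingWord≡word t) (≡.trans (word-cong t=t′) (≡.sym (readingWord≡word t′))))))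
             (∏-cong (λ j → reflexive (cong (λ I → minorDet R M I (elems B₀ j))
                                           (cong (map _) (rowsOf-cong (λ i j → cong is-just (t=t′ i j)) j))))
                     (allFin d))

    sign-map-word : ∀ {t : Tableau} → T (isJellyfish r B t) → sign (inv (map w (word t))) ≈ sign (inv (readingWord t)) * sgn
    sign-map-word {t} jt =
      ≈-trans (sign-inv-map w-injective (word t) (jellyfish-word-unique r π {t} jt))
              (*-cong (sign-cong (cong inv (≡.sym (readingWord≡word t))))
                      (sign-cong (cong (inv ∘ map w) (jellyfish-sort-word r π {t} jt))))

    summand-refill : ∀ {t : Tableau} → T (isJellyfish r B t) → summand M B′ (refill B′ t) ≈ sgn * summand (permCols R w M) B t
    summand-refill {t} jt = begin
      summand M B′ (refill B′ t)
        ≈⟨ *-cong (sign-cong (cong inv (readingWord≡word (refill B′ t))))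
                  (∏-cong (λ j → reflexive (cong (λ I → minorDet R M I (elems B′ j)) (cong (map _) (rowsOf-cong shapes j)))) (allFin d)) ⟩
      weight M S (rows t) (elems B′)
        ≈⟨ weight-cong M S (rows t) (≡.sym ∘ sort-map-elems w-injective B) ⟩
      weight M S (rows t) (sort ∘ mapped)
        ≈⟨ sort-all-columns M S (rows t) mapped (heights , subst Unique (≡.sym word-mapped) (Uniqueₚ.map⁺ w-injective (jellyfish-word-unique r π {t} jt))) ⟨
      weight M S (rows t) mapped
        ≈⟨ *-cong (sign-cong (cong inv word-mapped))
                  (∏-cong (λ j → reflexive (≡.sym (minorDet-permCols M w (rows t j) (elems B j)))) (allFin d)) ⟩
      sign (inv (map w (word t))) * Jpoly R (permCols R w M) r B t
        ≈⟨ *-congʳ (≈-trans (sign-map-word {t} jt) (*-comm _ _)) ⟩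
      sgn * sign (inv (readingWord t)) * Jpoly R (permCols R w M) r B t
        ≈⟨ *-assoc _ _ _ ⟩
      sgn * summand (permCols R w M) B t ∎
      where
      S = shape t
      mapped : Columns d n
      mapped j = map w (elems B j)
      columns = jellyfish-columns r t jt
      heights : ∀ j → height S j ≡ length (mapped j)
      heights j = ≡.trans (height-shape t j) (≡.trans (cong length (columns j)) (≡.sym (length-map w (elems B j))))
      word-mapped : word (fill S mapped) ≡ map w (word t)
      word-mapped = ≡.trans (word-fill-map w S (elems B)) (cong (map w) (word-cong (fill-shape t columns)))
      shapes : ∀ i j → shape (refill B′ t) i j ≡ shape t i j
      shapes = shape-fill S (elems B′) λ j → ℕ.≤-reflexive
        (≡.trans (height-shape t j) (≡.trans (cong length (columns j)) (≡.sym (length-elems-act w-injective B j))))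

    bracket-permCols : bracket R (permCols R w M) r B ≈ sgn * bracket R M r B′
    bracket-permCols = begin
      bracket R (permCols R w M) r B
        ≈⟨ ∑-filter (isJellyfish r B) (summand (permCols R w M) B) tableaux ⟩
      ∑ (map (λ t → 𝟙 (isJellyfish r B t) * summand (permCols R w M) B t) tableaux)
        ≈⟨ ∑-cong (λ t → 𝟙-*-cong (isJellyfish r B t) (unrefill t)) tableaux ⟩
      ∑ (map (λ t → 𝟙 (isJellyfish r B t) * (sgn * summand M B′ (refill B′ t))) tableaux)
        ≈⟨ ∑-cong (λ t → x∙yz≈y∙xz _ _ _) tableaux ⟩
      ∑ (map (λ t → sgn * (𝟙 (isJellyfish r B t) * summand M B′ (refill B′ t))) tableaux)
        ≈⟨ ∑-*ˡ sgn _ tableaux ⟩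
      sgn * ∑ (map (λ t → 𝟙 (isJellyfish r B t) * summand M B′ (refill B′ t)) tableaux)
        ≈⟨ *-congˡ (∑-reindex {xs = tableaux} arrays-picksOut arrayᵇ-sound arrayᵇ-complete (isJellyfish r B) (isJellyfish r B′)
                              (refill B′) (refill B) (summand M B′) (summand-cong B′)
                              (refill-correspondence r sizes) (refill-correspondence r (≡.sym ∘ sizes))) ⟩
      sgn * ∑ (map (λ t → 𝟙 (isJellyfish r B′ t) * summand M B′ t) tableaux)
        ≈⟨ *-congˡ (∑-filter (isJellyfish r B′) (summand M B′) tableaux) ⟨
      sgn * bracket R M r B′ ∎
      where
      tableaux = allArrays (numRows n d r) d n
      sizes = length-elems-act w-injective B
      unrefill : ∀ t → T (isJellyfish r B t) → summand (permCols R w M) B t ≈ sgn * summand M B′ (refill B′ t)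
      unrefill t jt = begin
        summand (permCols R w M) B t                 ≈⟨ *-identityˡ _ ⟨
        1# * summand (permCols R w M) B t            ≈⟨ *-congʳ (signPow-square (inv (map w (allFin n)))) ⟨
        sgn * sgn * summand (permCols R w M) B t     ≈⟨ *-assoc _ _ _ ⟩
        sgn * (sgn * summand (permCols R w M) B t)   ≈⟨ *-congˡ (summand-refill jt) ⟨
        sgn * summand M B′ (refill B′ t)             ∎

corollary5p8 : ∀ {c ℓ} (R : CommutativeRing c ℓ) (n d r : ℕ) → 0 < n → 0 < d → 0 < r →
    (π : Fin n → Fin d) → InOP n d r π →
    (M : Fin n → Fin n → CommutativeRing.Carrier R) →
    (CommutativeRing._≈_ R (bracket R (permCols R cyc M) r (blocksOf π))
       (CommutativeRing._*_ R (signPow R (n ∸ 1)) (bracket R M r (rot (blocksOf π)))))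
    × (CommutativeRing._≈_ R (bracket R (permCols R w₀ M) r (blocksOf π))
       (CommutativeRing._*_ R (signPow R (n C 2)) (bracket R M r (refl' (blocksOf π)))))
corollary5p8 R n d r _ _ _ π _ M =
  trans (bracket-permCols R r π cyc-injective M) (*-congʳ (reflexive (cong (signPow R) (inv-cyc n)))) ,
  trans (bracket-permCols R r π w₀-injective M) (*-congʳ (reflexive (cong (signPow R) (inv-w₀ n))))
  where open CommutativeRing R
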